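{- Let $N\geq0$, let $w=e_{u_1v_1}\cdots e_{u_kv_k}$ be an admissible word, and put $m(w):=1+\#\{h\mid u_hv_h\neq AD\}$. Let $F=\mathbb{Q}(B,D,q)$ be the rational function field in indeterminates $B,D,q$, and set $A:=q^ND$ and $C:=q^{N-m(w)}D^2/B$ (so that $A=q^ND$ and $AD=BCq^{m(w)}$). Then $L_q(w)=L_q(\tau(w))$ in $F$.
   Context: Words: $W$ is the set of finite words in the six formal letters $e_{AB},e_{AC},e_{AD},e_{BC},e_{BD},e_{CD}$; a letter $e_{uv}$ has first entry $u$ and second entry $v$. $\tau:W\to W$ is the anti-automorphism with $\tau(e_{AB})=e_{CD}$, $\tau(e_{AC})=e_{BD}$, $\tau(e_{AD})=e_{AD}$, $\tau(e_{BC})=e_{BC}$, $\tau(e_{BD})=e_{AC}$, $\tau(e_{CD})=e_{AB}$ (i.e. $\tau(e_{uv})=e_{\sigma(v)\sigma(u)}$ with $\sigma$ swapping $A\leftrightarrow D$, $B\leftrightarrow C$). A word is admissible if it does not begin with $e_{AB},e_{AC},e_{AD}$ and does not end with $e_{AD},e_{BD},e_{CD}$. $q$-integrals: for $x,y\in F^\times$ write $x\trianglelefteq y$ iff $y/x\in\{q^{ -n}\mid n\geq0\}$; for $x\trianglelefteq y$ and $u_j,v_j$ not equal to any $t$ with $x\trianglelefteq t\trianglelefteq y$, $I_q(x;[u_1,v_1],\dots,[u_k,v_k];y):=\sum_{x\trianglelefteq t_1\trianglelefteq\cdots\trianglelefteq t_k\trianglelefteq y}\prod_j\left(\frac{t_j}{t_j-u_j}-\frac{t_j}{t_j-v_j}\right)$.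 Functional: for $w=e_{u_1v_1}\cdots e_{u_kv_k}$ and $1\leq j\leq k$ put $A^{(j)}:=Aq^{\#\{h\leq j\mid u_hv_h\in\{BC,BD,CD\}\}}$, $B^{(j)}:=Bq^{\#\{h\leq j\mid u_hv_h\notin\{AC,AD\}\}+\#\{h\geq j\mid u_hv_h=CD\}}$, $C^{(j)}:=Cq^{\#\{h\leq j\mid u_hv_h\notin\{AB,AD\}\}+\#\{h\geq j\mid u_hv_h=BD\}}$, $D^{(j)}:=Dq^{ -\#\{h\geq j\mid u_hv_h\in\{AB,AC,BC\}\}}$, and $L_q(w):=I_q(A;[u_1^{(1)},v_1^{(1)}],\dots,[u_k^{(k)},v_k^{(k)}];D)$, where $u_j^{(j)}$ denotes $X^{(j)}$ for the parameter $X\in\{A,B,C,D\}$ named by $u_j$ (similarly $v_j^{(j)}$). $L_q$ of the empty word is $1$. -}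

module Defs where

open import Data.Nat as ℕ using (ℕ; zero; suc; _∸_)
open import Data.Integer as ℤ using (ℤ; +_; -[1+_]; 0ℤ; 1ℤ)
open import Data.Bool using (Bool; true; false; if_then_else_; not; _∧_; T)
open import Data.List using (List; []; _∷_; _++_; [_]; reverse; map; foldr; concatMap; upTo)
open import Data.Product using (_×_; _,_; Σ; ∃)
open import Data.Unit using (⊤)
open import Relation.Nullary using (¬_)
open import Relation.Nullary.Decidable using (⌊_⌋)
open import Relation.Binary.PropositionalEquality using (_≡_)

data Letter : Set where
  eAB eAC eAD eBC eBD eCD : Letter

Word : Set
Word = List Letter

data Param : Set where
  pA pB pC pD : Param

first : Letter → Param
first eAB = pA
first eAC = pA
first eAD = pA
first eBC = pB
first eBD = pB
first eCD = pC

second : Letter → Param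
second eAB = pB
second eAC = pC
second eAD = pD
second eBC = pC
second eBD = pD
second eCD = pD

τℓ : Letter → Letter
τℓ eAB = eCD
τℓ eAC = eBD
τℓ eAD = eAD
τℓ eBC = eBC
τℓ eBD = eAC
τℓ eCD = eAB

τ : Word → Word
τ w = reverse (map τℓ w)

badStart : Letter → Bool
badStart eAB = true
badStart eAC = true
badStart eAD = true
badStart _   = false

badEnd : Letter → Bool
badEnd eAD = true
badEnd eBD = true
badEnd eCD = true
badEnd _   = false

headOK : (Letter → Bool) → Word → Set
headOK bad []      = ⊤
headOK bad (ℓ ∷ _) = T (not (bad ℓ))

Admissible : Word → Set
Admissible w = headOK badStart w × headOK badEnd (reverse w)

count : (Letter → Bool) → Word → ℕ
count p []      = 0
count p (ℓ ∷ w) = if p ℓ then suc (count p w) else count p w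

isNotAD : Letter → Bool
isNotAD eAD = false
isNotAD _   = true

m : Word → ℕ
m w = suc (count isNotAD w)

-- The field F = ℚ(B,D,q), realised as the fraction field of the
-- Laurent polynomial ring ℤ[B^±1, D^±1, q^±1].

-- exponents of (B , D , q)
Exp : Set
Exp = ℤ × ℤ × ℤ

eqE : Exp → Exp → Bool
eqE (a , b , c) (a' , b' , c') = ⌊ a ℤ.≟ a' ⌋ ∧ (⌊ b ℤ.≟ b' ⌋ ∧ ⌊ c ℤ.≟ c' ⌋)

addE : Exp → Exp → Exp
addE (a , b , c) (a' , b' , c') = (a ℤ.+ a') , (b ℤ.+ b') , (c ℤ.+ c')

-- a Laurent polynomial: a finite formal sum of monomials  coeff · B^i D^j q^k
Poly : Set
Poly = List (ℤ × Exp)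

coeff : Poly → Exp → ℤ
coeff []             e = 0ℤ
coeff ((c , e') ∷ p) e = (if eqE e' e then c else 0ℤ) ℤ.+ coeff p e

_≈P_ : Poly → Poly → Set
p ≈P r = ∀ e → coeff p e ≡ coeff r e

NonZeroP : Poly → Set
NonZeroP p = Σ Exp (λ e → ¬ (coeff p e ≡ 0ℤ))

_+P_ : Poly → Poly → Poly
p +P r = p ++ r

negP : Poly → Poly
negP = map (λ { (c , e) → (ℤ.- c , e) })

_-P_ : Poly → Poly → Poly
p -P r = p +P negP r

_*P_ : Poly → Poly → Poly
p *P r = concatMap (λ { (c , e) → map (λ { (d , f) → (c ℤ.* d , addE e f) }) r }) p

mono : ℤ → ℤ → ℤ → ℤ → Poly
mono c i j k = [ (c , (i , j , k)) ]

oneP : Poly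
oneP = mono 1ℤ 0ℤ 0ℤ 0ℤ

record Frac : Set where
  constructor _/_
  field
    num : Poly
    den : Poly
open Frac public

_≈F_ : Frac → Frac → Set
x ≈F y = (num x *P den y) ≈P (num y *P den x)

zeroF oneF : Frac
zeroF = [] / oneP
oneF  = oneP / oneP

_+F_ : Frac → Frac → Frac
(a / b) +F (c / d) = ((a *P d) +P (c *P b)) / (b *P d)

_-F_ : Frac → Frac → Frac
(a / b) -F (c / d) = ((a *P d) -P (c *P b)) / (b *P d)

_*F_ : Frac → Frac → Frac
(a / b) *F (c / d) = (a *P c) / (b *P d)

sumF : List Frac → Frac
sumF = foldr _+F_ zeroF

-- q-integrals.  For x ⊴ y with y / x = q^{-N}, the t with x ⊴ t ⊴ y are
-- exactly t = x q^{-n}, 0 ≤ n ≤ N (q is transcendental), and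
-- t_1 ⊴ ... ⊴ t_k  means  n_1 ≤ ... ≤ n_k.

range : ℕ → ℕ → List ℕ
range lo N = map (lo ℕ.+_) (upTo (suc N ∸ lo))

qInv : ℕ → Poly
qInv n = mono 1ℤ 0ℤ 0ℤ (ℤ.- (+ n))

factor : Poly → Poly → Poly → Frac
factor t u v = (t / (t -P u)) -F (t / (t -P v))

IqFrom : Poly → ℕ → List (Poly × Poly) → ℕ → Frac
IqFrom x N []             lo = oneF
IqFrom x N ((u , v) ∷ ps) lo =
  sumF (map (λ n → factor (x *P qInv n) u v *F IqFrom x N ps n) (range lo N))

-- I_q(x; [u_1,v_1],...,[u_k,v_k]; y)  where y = x q^{-N}
Iq : Poly → ℕ → List (Poly × Poly) → Frac
Iq x N ps = IqFrom x N ps 0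

isBCD : Letter → Bool
isBCD eBC = true
isBCD eBD = true
isBCD eCD = true
isBCD _   = false

notACAD : Letter → Bool
notACAD eAC = false
notACAD eAD = false
notACAD _   = true

notABAD : Letter → Bool
notABAD eAB = false
notABAD eAD = false
notABAD _   = true

isCD : Letter → Bool
isCD eCD = true
isCD _   = false

isBD : Letter → Bool
isBD eBD = true
isBD _   = false

isABACBC : Letter → Bool
isABACBC eAB = true
isABACBC eAC = true
isABACBC eBC = true
isABACBC _   = false

-- X^{(j)} as an element of F, given N, m(w), the prefix  h ≤ j  and the
-- suffix  h ≥ j  of the word (both containing position j).
paramVal : ℕ → ℕ → Param → Word → Word → Poly
paramVal N mw pA pre suf = mono 1ℤ 0ℤ (+ 1) (+ N ℤ.+ + count isBCD pre)
paramVal N mw pB pre suf = mono 1ℤ (+ 1) 0ℤ (+ (count notACAD pre ℕ.+ count isCD suf))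
paramVal N mw pC pre suf =
  mono 1ℤ -[1+ 0 ] (+ 2) ((+ N ℤ.- + mw) ℤ.+ + (count notABAD pre ℕ.+ count isBD suf))
paramVal N mw pD pre suf = mono 1ℤ 0ℤ (+ 1) (ℤ.- (+ count isABACBC suf))

positions : Word → Word → List (Letter × Word × Word)
positions pre []      = []
positions pre (ℓ ∷ w) = (ℓ , pre ++ [ ℓ ] , ℓ ∷ w) ∷ positions (pre ++ [ ℓ ]) w

Lq : ℕ → Word → Frac
Lq N w = Iq (mono 1ℤ 0ℤ (+ 1) (+ N)) N
  (map (λ { (ℓ , pre , suf) → paramVal N (m w) (first ℓ) pre suf
                            , paramVal N (m w) (second ℓ) pre suf })
       (positions [] w))

{-# OPTIONS --safe #-}

-- The substitution t ↦ AD/t maps the points A q^{-n} (0 ≤ n ≤ N) of the q-integral from A to D = A q^{-N}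
-- onto themselves, sending n to N − n, and turns t/(t − u) − t/(t − v) into the same expression at AD/t
-- with [u, v] replaced by [AD/v, AD/u]. Position j of w corresponds to position k + 1 − j of τ(w), where the
-- parameter σ(X) equals AD/X^{(j)} (σ swapping A ↔ D and B ↔ C): τ exchanges the letters counted in the
-- exponents of A and D, and for B and C one also needs AD = BC q^{m(w)}. Hence L_q(w) and L_q(τ w) are the
-- same sum over chains n_1 ≤ ⋯ ≤ n_k read backwards. Admissibility keeps every parameter off the points t,
-- so no denominator vanishes.
--
-- F is realised by fractions of Laurent polynomials over ℤ. These form an integral domain (compare leading
-- monomials in the lexicographic order), so the fractions with nonzero denominator form a commutative
-- semiring, in which the reversal of chain sums is carried out.

module Submission where

open import Defs

open import Algebra.Bundles using (CommutativeRing; CommutativeSemiring)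
import Algebra.Solver.Ring
open import Algebra.Solver.Ring.AlmostCommutativeRing using (fromCommutativeRing; _-Raw-AlmostCommutative⟶_)
open import Data.Bool using (Bool; true; false; not; T; if_then_else_)
open import Data.Integer as ℤ using (ℤ; +_; -[1+_]; 0ℤ; 1ℤ)
import Data.Integer.Properties as ℤ
open import Algebra.Properties.AbelianGroup ℤ.+-0-abelianGroup using (∙-cancelˡ)
open import Data.Integer.Solver using (module +-*-Solver)
open import Data.List using (List; []; _∷_; _++_; [_]; _∷ʳ_; map; foldr; reverse; length; applyUpTo)
import Data.List.Properties as List
open import Data.List.Membership.Propositional using (_∈_)
open import Data.List.Relation.Binary.Pointwise as Pointwise using (Pointwise; []; _∷_)
open import Data.List.Relation.Unary.All as All using (All; []; _∷_)
open import Data.List.Relation.Unary.All.Properties using (applyUpTo⁺₁) renaming (map⁺ to All-map⁺)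
open import Data.List.Relation.Unary.Any using (here; there)
open import Data.Maybe as Maybe using (Maybe)
open import Data.Nat as ℕ using (ℕ; zero; suc; _∸_; _<_; _≤_)
import Data.Nat.Properties as ℕ
import Data.Nat.Solver as NatSolver
open import Data.Product using (Σ; _×_; _,_; proj₁; proj₂; ∃₂)
open import Data.Sum using (_⊎_; inj₁; inj₂; [_,_]′)
open import Function using (_∘_; _∘′_; id)
open import Level using (0ℓ)
open import Relation.Binary.Definitions using (DecidableEquality; tri<; tri≈; tri>)
open import Relation.Binary.PropositionalEquality hiding ([_]; setoid)
import Relation.Binary.Reasoning.Setoid as SetoidReasoning
open import Relation.Binary.Structures using (IsEquivalence)
open import Relation.Nullary using (¬_; yes; no; contradiction; ¬?; _because_)
open import Relation.Nullary.Decidable using (dec⇒maybe)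
open import Relation.Nullary.Reflects using (Reflects; ofʸ; ofⁿ; det)
open import Relation.Unary using (Decidable)

open CommutativeRing using (rawRing)

negE : Exp → Exp
negE (a , b , c) = ℤ.- a , ℤ.- b , ℤ.- c

0E : Exp
0E = 0ℤ , 0ℤ , 0ℤ

subE : Exp → Exp → Exp
subE e a = addE e (negE a)

≡-triple : ∀ {a b c a′ b′ c′ : ℤ} → a ≡ a′ → b ≡ b′ → c ≡ c′ → (a , b , c) ≡ (a′ , b′ , c′)
≡-triple refl refl refl = refl

eqE-reflects : ∀ a b → Reflects (a ≡ b) (eqE a b)
eqE-reflects (a , b , c) (a′ , b′ , c′) with a ℤ.≟ a′ | b ℤ.≟ b′ | c ℤ.≟ c′
... | yes refl | yes refl | yes refl = ofʸ refl
... | no a≢a′  | _        | _        = ofⁿ λ { refl → a≢a′ refl }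
... | yes _    | no b≢b′  | _        = ofⁿ λ { refl → b≢b′ refl }
... | yes _    | yes _    | no c≢c′  = ofⁿ λ { refl → c≢c′ refl }

_≟E_ : DecidableEquality Exp
a ≟E b = eqE a b because eqE-reflects a b

eqE-refl : ∀ e → eqE e e ≡ true
eqE-refl e with eqE e e | eqE-reflects e e
... | true  | _      = refl
... | false | ofⁿ ¬p = contradiction refl ¬p

addE-comm : ∀ a b → addE a b ≡ addE b a
addE-comm (a , b , c) (a′ , b′ , c′) = ≡-triple (ℤ.+-comm a a′) (ℤ.+-comm b b′) (ℤ.+-comm c c′)

addE-assoc : ∀ a b c → addE (addE a b) c ≡ addE a (addE b c)
addE-assoc (a , b , c) (a′ , b′ , c′) (a″ , b″ , c″) =
  ≡-triple (ℤ.+-assoc a a′ a″) (ℤ.+-assoc b b′ b″) (ℤ.+-assoc c c′ c″)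

subE-identityʳ : ∀ e → subE e 0E ≡ e
subE-identityʳ (a , b , c) = ≡-triple (ℤ.+-identityʳ a) (ℤ.+-identityʳ b) (ℤ.+-identityʳ c)

addE-inverseʳ : ∀ a → addE a (negE a) ≡ 0E
addE-inverseʳ (a , b , c) = ≡-triple (ℤ.+-inverseʳ a) (ℤ.+-inverseʳ b) (ℤ.+-inverseʳ c)

subE-addE : ∀ a b → subE (addE a b) a ≡ b
subE-addE (a , b , c) (a′ , b′ , c′) = ≡-triple (cancel a a′) (cancel b b′) (cancel c c′)
  where
  open +-*-Solver
  cancel : ∀ x y → x ℤ.+ y ℤ.+ ℤ.- x ≡ y
  cancel = solve 2 (λ x y → x :+ y :- x := y) refl

addE-subE : ∀ a e → addE a (subE e a) ≡ e
addE-subE (a , b , c) (a′ , b′ , c′) = ≡-triple (cancel a a′) (cancel b b′) (cancel c c′)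
  where
  open +-*-Solver
  cancel : ∀ x z → x ℤ.+ (z ℤ.+ ℤ.- x) ≡ z
  cancel = solve 2 (λ x z → x :+ (z :- x) := z) refl

addE≡⇒≡subE : ∀ {a b e} → addE a b ≡ e → b ≡ subE e a
addE≡⇒≡subE {a} {b} refl = sym (subE-addE a b)

≡subE⇒addE≡ : ∀ {a b e} → b ≡ subE e a → addE a b ≡ e
≡subE⇒addE≡ {a} {e = e} refl = addE-subE a e

eqE-addE : ∀ a b e → eqE (addE a b) e ≡ eqE b (subE e a)
eqE-addE a b e = det (eqE-reflects (addE a b) e) (transport (eqE-reflects b (subE e a)))
  where
  transport : ∀ {x} → Reflects (b ≡ subE e a) x → Reflects (addE a b ≡ e) x
  transport (ofʸ p)  = ofʸ (≡subE⇒addE≡ p)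
  transport (ofⁿ ¬p) = ofⁿ (¬p ∘ addE≡⇒≡subE)

-- The ring of Laurent polynomials

sumWith : Poly → (Exp → ℤ) → ℤ
sumWith []            g = 0ℤ
sumWith ((c , e) ∷ p) g = c ℤ.* g e ℤ.+ sumWith p g

δ : Exp → Exp → ℤ
δ e x = if eqE x e then 1ℤ else 0ℤ

coeff≡sumWith-δ : ∀ p e → coeff p e ≡ sumWith p (δ e)
coeff≡sumWith-δ []             e = refl
coeff≡sumWith-δ ((c , e′) ∷ p) e = cong₂ ℤ._+_ (select (eqE e′ e)) (coeff≡sumWith-δ p e)
  where
  select : ∀ b → (if b then c else 0ℤ) ≡ c ℤ.* (if b then 1ℤ else 0ℤ)
  select true  = sym (ℤ.*-identityʳ c)
  select false = sym (ℤ.*-zeroʳ c)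

δ-addE : ∀ e a b → δ e (addE a b) ≡ δ (subE e a) b
δ-addE e a b rewrite eqE-addE a b e = refl

sumWith-cong : ∀ p {g h} → (∀ x → g x ≡ h x) → sumWith p g ≡ sumWith p h
sumWith-cong []            g≗h = refl
sumWith-cong ((c , e) ∷ p) g≗h = cong₂ ℤ._+_ (cong (c ℤ.*_) (g≗h e)) (sumWith-cong p g≗h)

sumWith-++ : ∀ p r g → sumWith (p ++ r) g ≡ sumWith p g ℤ.+ sumWith r g
sumWith-++ []            r g = sym (ℤ.+-identityˡ _)
sumWith-++ ((c , e) ∷ p) r g rewrite sumWith-++ p r g = sym (ℤ.+-assoc (c ℤ.* g e) _ _)

sumWith-+ : ∀ p g h → sumWith p (λ x → g x ℤ.+ h x) ≡ sumWith p g ℤ.+ sumWith p h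
sumWith-+ []            g h = refl
sumWith-+ ((c , e) ∷ p) g h rewrite sumWith-+ p g h =
  solve 5 (λ c a b s t → c :* (a :+ b) :+ (s :+ t) := c :* a :+ s :+ (c :* b :+ t))
    refl c (g e) (h e) (sumWith p g) (sumWith p h)
  where open +-*-Solver

sumWith-*ˡ : ∀ p k g → sumWith p (λ x → k ℤ.* g x) ≡ k ℤ.* sumWith p g
sumWith-*ˡ []            k g = sym (ℤ.*-zeroʳ k)
sumWith-*ˡ ((c , e) ∷ p) k g rewrite sumWith-*ˡ p k g =
  solve 4 (λ c k a s → c :* (k :* a) :+ k :* s := k :* (c :* a :+ s)) refl c k (g e) (sumWith p g)
  where open +-*-Solver

sumWith-zero : ∀ p → sumWith p (λ _ → 0ℤ) ≡ 0ℤ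
sumWith-zero []            = refl
sumWith-zero ((c , e) ∷ p) rewrite sumWith-zero p | ℤ.*-zeroʳ c = refl

sumWith-comm : ∀ p r (h : Exp → Exp → ℤ) →
               sumWith p (λ a → sumWith r (h a)) ≡ sumWith r (λ b → sumWith p (λ a → h a b))
sumWith-comm []            r h = sym (sumWith-zero r)
sumWith-comm ((c , e) ∷ p) r h = begin
  c ℤ.* sumWith r (h e) ℤ.+ sumWith p (λ a → sumWith r (h a))
    ≡⟨ cong₂ ℤ._+_ (sym (sumWith-*ˡ r c (h e))) (sumWith-comm p r h) ⟩
  sumWith r (λ b → c ℤ.* h e b) ℤ.+ sumWith r (λ b → sumWith p (λ a → h a b))
    ≡⟨ sym (sumWith-+ r _ _) ⟩
  sumWith r (λ b → c ℤ.* h e b ℤ.+ sumWith p (λ a → h a b)) ∎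
  where open ≡-Reasoning

sumWith-monomial-*P : ∀ c e r g → sumWith (((c , e) ∷ []) *P r) g ≡ c ℤ.* sumWith r (g ∘ addE e)
sumWith-monomial-*P c e []            g = sym (ℤ.*-zeroʳ c)
sumWith-monomial-*P c e ((d , f) ∷ r) g =
  trans (cong (λ s → c ℤ.* d ℤ.* g (addE e f) ℤ.+ s) (sumWith-monomial-*P c e r g))
        (solve 4 (λ c d x s → c :* d :* x :+ c :* s := c :* (d :* x :+ s)) refl c d (g (addE e f)) (sumWith r (g ∘ addE e)))
  where open +-*-Solver

*P-∷ : ∀ t p r → (t ∷ p) *P r ≡ ((t ∷ []) *P r) ++ (p *P r)
*P-∷ (c , e) p r = cong (_++ (p *P r)) (sym (List.++-identityʳ _))

sumWith-*P : ∀ p r g → sumWith (p *P r) g ≡ sumWith p (λ a → sumWith r (g ∘ addE a))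
sumWith-*P []            r g = refl
sumWith-*P ((c , e) ∷ p) r g = begin
  sumWith (((c , e) ∷ p) *P r) g
    ≡⟨ cong (λ s → sumWith s g) (*P-∷ (c , e) p r) ⟩
  sumWith ((((c , e) ∷ []) *P r) ++ (p *P r)) g
    ≡⟨ sumWith-++ (((c , e) ∷ []) *P r) (p *P r) g ⟩
  sumWith (((c , e) ∷ []) *P r) g ℤ.+ sumWith (p *P r) g
    ≡⟨ cong₂ ℤ._+_ (sumWith-monomial-*P c e r g) (sumWith-*P p r g) ⟩
  c ℤ.* sumWith r (g ∘ addE e) ℤ.+ sumWith p (λ a → sumWith r (g ∘ addE a)) ∎
  where open ≡-Reasoning

coeff-++ : ∀ p r e → coeff (p ++ r) e ≡ coeff p e ℤ.+ coeff r e
coeff-++ p r e rewrite coeff≡sumWith-δ (p ++ r) e | coeff≡sumWith-δ p e | coeff≡sumWith-δ r e = sumWith-++ p r (δ e)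

coeff-negP : ∀ p e → coeff (negP p) e ≡ ℤ.- coeff p e
coeff-negP []             e = refl
coeff-negP ((c , e′) ∷ p) e rewrite coeff-negP p e with eqE e′ e
... | true  = sym (ℤ.neg-distrib-+ c (coeff p e))
... | false = sym (ℤ.neg-distrib-+ 0ℤ (coeff p e))

coeff--P : ∀ p r e → coeff (p -P r) e ≡ coeff p e ℤ.- coeff r e
coeff--P p r e = trans (coeff-++ p (negP r) e) (cong (λ x → coeff p e ℤ.+ x) (coeff-negP r e))

coeff-*Pˡ : ∀ p r e → coeff (p *P r) e ≡ sumWith p (λ a → coeff r (subE e a))
coeff-*Pˡ p r e = begin
  coeff (p *P r) e                               ≡⟨ coeff≡sumWith-δ (p *P r) e ⟩
  sumWith (p *P r) (δ e)                         ≡⟨ sumWith-*P p r (δ e) ⟩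
  sumWith p (λ a → sumWith r (δ e ∘ addE a))     ≡⟨ sumWith-cong p (λ a → sumWith-cong r (δ-addE e a)) ⟩
  sumWith p (λ a → sumWith r (δ (subE e a)))     ≡⟨ sumWith-cong p (λ a → sym (coeff≡sumWith-δ r (subE e a))) ⟩
  sumWith p (λ a → coeff r (subE e a))           ∎
  where open ≡-Reasoning

coeff-*Pʳ : ∀ p r e → coeff (p *P r) e ≡ sumWith r (λ b → coeff p (subE e b))
coeff-*Pʳ p r e = begin
  coeff (p *P r) e                               ≡⟨ coeff≡sumWith-δ (p *P r) e ⟩
  sumWith (p *P r) (δ e)                         ≡⟨ sumWith-*P p r (δ e) ⟩
  sumWith p (λ a → sumWith r (δ e ∘ addE a))     ≡⟨ sumWith-comm p r (λ a b → δ e (addE a b)) ⟩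
  sumWith r (λ b → sumWith p (λ a → δ e (addE a b)))
    ≡⟨ sumWith-cong r (λ b → sumWith-cong p (λ a → trans (cong (δ e) (addE-comm a b)) (δ-addE e b a))) ⟩
  sumWith r (λ b → sumWith p (δ (subE e b)))     ≡⟨ sumWith-cong r (λ b → sym (coeff≡sumWith-δ p (subE e b))) ⟩
  sumWith r (λ b → coeff p (subE e b))           ∎
  where open ≡-Reasoning

≈P-isEquivalence : IsEquivalence _≈P_
≈P-isEquivalence = record
  { refl  = λ _ → refl
  ; sym   = λ p≈r e → sym (p≈r e)
  ; trans = λ p≈r r≈s e → trans (p≈r e) (r≈s e)
  }

+P-cong : ∀ {p p′ r r′} → p ≈P p′ → r ≈P r′ → (p +P r) ≈P (p′ +P r′)
+P-cong {p} {p′} {r} {r′} p≈p′ r≈r′ e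
  rewrite coeff-++ p r e | coeff-++ p′ r′ e = cong₂ ℤ._+_ (p≈p′ e) (r≈r′ e)

+P-assoc : ∀ p r s → ((p +P r) +P s) ≈P (p +P (r +P s))
+P-assoc p r s e rewrite List.++-assoc p r s = refl

+P-comm : ∀ p r → (p +P r) ≈P (r +P p)
+P-comm p r e rewrite coeff-++ p r e | coeff-++ r p e = ℤ.+-comm (coeff p e) (coeff r e)

+P-identityʳ : ∀ p → (p +P []) ≈P p
+P-identityʳ p e rewrite List.++-identityʳ p = refl

negP-inverseˡ : ∀ p → (negP p +P p) ≈P []
negP-inverseˡ p e rewrite coeff-++ (negP p) p e | coeff-negP p e = ℤ.+-inverseˡ (coeff p e)

negP-inverseʳ : ∀ p → (p +P negP p) ≈P []
negP-inverseʳ p e rewrite coeff-++ p (negP p) e | coeff-negP p e = ℤ.+-inverseʳ (coeff p e)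

negP-cong : ∀ {p r} → p ≈P r → negP p ≈P negP r
negP-cong {p} {r} p≈r e rewrite coeff-negP p e | coeff-negP r e = cong ℤ.-_ (p≈r e)

*P-cong : ∀ {p p′ r r′} → p ≈P p′ → r ≈P r′ → (p *P r) ≈P (p′ *P r′)
*P-cong {p} {p′} {r} {r′} p≈p′ r≈r′ e = begin
  coeff (p *P r) e                        ≡⟨ coeff-*Pʳ p r e ⟩
  sumWith r (λ b → coeff p (subE e b))    ≡⟨ sumWith-cong r (λ b → p≈p′ (subE e b)) ⟩
  sumWith r (λ b → coeff p′ (subE e b))   ≡⟨ sym (coeff-*Pʳ p′ r e) ⟩
  coeff (p′ *P r) e                       ≡⟨ coeff-*Pˡ p′ r e ⟩
  sumWith p′ (λ a → coeff r (subE e a))   ≡⟨ sumWith-cong p′ (λ a → r≈r′ (subE e a)) ⟩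
  sumWith p′ (λ a → coeff r′ (subE e a))  ≡⟨ sym (coeff-*Pˡ p′ r′ e) ⟩
  coeff (p′ *P r′) e                      ∎
  where open ≡-Reasoning

*P-assoc : ∀ p r s → ((p *P r) *P s) ≈P (p *P (r *P s))
*P-assoc p r s e = begin
  coeff ((p *P r) *P s) e
    ≡⟨ coeff≡sumWith-δ ((p *P r) *P s) e ⟩
  sumWith ((p *P r) *P s) (δ e)
    ≡⟨ sumWith-*P (p *P r) s (δ e) ⟩
  sumWith (p *P r) (λ x → sumWith s (δ e ∘ addE x))
    ≡⟨ sumWith-*P p r _ ⟩
  sumWith p (λ a → sumWith r (λ b → sumWith s (δ e ∘ addE (addE a b))))
    ≡⟨ sumWith-cong p (λ a → sumWith-cong r (λ b → sumWith-cong s (λ c → cong (δ e) (addE-assoc a b c)))) ⟩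
  sumWith p (λ a → sumWith r (λ b → sumWith s (λ c → δ e (addE a (addE b c)))))
    ≡⟨ sumWith-cong p (λ a → sym (sumWith-*P r s (δ e ∘ addE a))) ⟩
  sumWith p (λ a → sumWith (r *P s) (δ e ∘ addE a))
    ≡⟨ sym (sumWith-*P p (r *P s) (δ e)) ⟩
  sumWith (p *P (r *P s)) (δ e)
    ≡⟨ sym (coeff≡sumWith-δ (p *P (r *P s)) e) ⟩
  coeff (p *P (r *P s)) e ∎
  where open ≡-Reasoning

*P-comm : ∀ p r → (p *P r) ≈P (r *P p)
*P-comm p r e = trans (coeff-*Pˡ p r e) (sym (coeff-*Pʳ r p e))

*P-identityˡ : ∀ p → (oneP *P p) ≈P p
*P-identityˡ p e rewrite coeff-*Pˡ oneP p e | subE-identityʳ e = trans (ℤ.+-identityʳ _) (ℤ.*-identityˡ _)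

*P-identityʳ : ∀ p → (p *P oneP) ≈P p
*P-identityʳ p e = trans (*P-comm p oneP e) (*P-identityˡ p e)

*P-distribˡ : ∀ p r s → (p *P (r +P s)) ≈P ((p *P r) +P (p *P s))
*P-distribˡ p r s e = begin
  coeff (p *P (r +P s)) e
    ≡⟨ coeff-*Pˡ p (r +P s) e ⟩
  sumWith p (λ a → coeff (r ++ s) (subE e a))
    ≡⟨ sumWith-cong p (λ a → coeff-++ r s (subE e a)) ⟩
  sumWith p (λ a → coeff r (subE e a) ℤ.+ coeff s (subE e a))
    ≡⟨ sumWith-+ p _ _ ⟩
  sumWith p (λ a → coeff r (subE e a)) ℤ.+ sumWith p (λ a → coeff s (subE e a))
    ≡⟨ sym (cong₂ ℤ._+_ (coeff-*Pˡ p r e) (coeff-*Pˡ p s e)) ⟩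
  coeff (p *P r) e ℤ.+ coeff (p *P s) e
    ≡⟨ sym (coeff-++ (p *P r) (p *P s) e) ⟩
  coeff ((p *P r) +P (p *P s)) e ∎
  where open ≡-Reasoning

*P-distribʳ : ∀ p r s → ((r +P s) *P p) ≈P ((r *P p) +P (s *P p))
*P-distribʳ p r s e =
  trans (*P-comm (r +P s) p e) (trans (*P-distribˡ p r s e) (+P-cong {p *P r} {r *P p} {p *P s} {s *P p} (*P-comm p r) (*P-comm p s) e))

*P-congˡ : ∀ z x y → x ≈P y → (z *P x) ≈P (z *P y)
*P-congˡ z x y x≈y = *P-cong {z} {z} {x} {y} (λ _ → refl) x≈y

*P-congʳ : ∀ z x y → x ≈P y → (x *P z) ≈P (y *P z)
*P-congʳ z x y x≈y = *P-cong {x} {y} {z} {z} x≈y (λ _ → refl)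

-P-cong : ∀ a a′ b b′ → a ≈P a′ → b ≈P b′ → (a -P b) ≈P (a′ -P b′)
-P-cong a a′ b b′ a≈a′ b≈b′ = +P-cong {a} {a′} {negP b} {negP b′} a≈a′ (negP-cong {b} {b′} b≈b′)

Poly-commutativeRing : CommutativeRing 0ℓ 0ℓ
Poly-commutativeRing = record
  { Carrier = Poly ; _≈_ = _≈P_ ; _+_ = _+P_ ; _*_ = _*P_ ; -_ = negP ; 0# = [] ; 1# = oneP
  ; isCommutativeRing = record
    { isRing = record
      { +-isAbelianGroup = record
        { isGroup = record
          { isMonoid = record
            { isSemigroup = record
              { isMagma = record { isEquivalence = ≈P-isEquivalence ; ∙-cong = λ {p p′ r r′} → +P-cong {p} {p′} {r} {r′} }
              ; assoc = +P-assoc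
              }
            ; identity = (λ p e → refl) , +P-identityʳ
            }
          ; inverse = negP-inverseˡ , negP-inverseʳ
          ; ⁻¹-cong = λ {p r} → negP-cong {p} {r}
          }
        ; comm = +P-comm
        }
      ; *-cong = λ {p p′ r r′} → *P-cong {p} {p′} {r} {r′}
      ; *-assoc = *P-assoc
      ; *-identity = *P-identityˡ , *P-identityʳ
      ; distrib = *P-distribˡ , *P-distribʳ
      }
    ; *-comm = *P-comm
    }
  }

constP : ℤ → Poly
constP c = (c , 0E) ∷ []

constP-homomorphism : (rawRing ℤ.+-*-commutativeRing) -Raw-AlmostCommutative⟶ fromCommutativeRing Poly-commutativeRing
constP-homomorphism = record
  { ⟦_⟧    = constP
  ; +-homo = λ a b e → +-homo a b (eqE 0E e)
  ; *-homo = λ a b e → refl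
  ; -‿homo = λ a e → refl
  ; 0-homo = λ e → 0-homo (eqE 0E e)
  ; 1-homo = λ e → refl
  }
  where
  +-homo : ∀ a b x → (if x then a ℤ.+ b else 0ℤ) ℤ.+ 0ℤ ≡ (if x then a else 0ℤ) ℤ.+ ((if x then b else 0ℤ) ℤ.+ 0ℤ)
  +-homo a b true  = trans (ℤ.+-identityʳ (a ℤ.+ b)) (cong (λ x → a ℤ.+ x) (sym (ℤ.+-identityʳ b)))
  +-homo a b false = refl
  0-homo : ∀ x → (if x then 0ℤ else 0ℤ) ℤ.+ 0ℤ ≡ 0ℤ
  0-homo true  = refl
  0-homo false = refl

constP-≟ : ∀ a b → Maybe (constP a ≈P constP b)
constP-≟ a b = Maybe.map (λ { refl _ → refl }) (dec⇒maybe (a ℤ.≟ b))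

module PolySolver = Algebra.Solver.Ring (rawRing ℤ.+-*-commutativeRing) (fromCommutativeRing Poly-commutativeRing)
  constP-homomorphism constP-≟

module ≈P-Reasoning = SetoidReasoning (CommutativeRing.setoid Poly-commutativeRing)

-- Laurent polynomials form an integral domain

data _<E_ : Exp → Exp → Set where
  <E-first  : ∀ {a b c a′ b′ c′} → a ℤ.< a′ → (a , b , c) <E (a′ , b′ , c′)
  <E-second : ∀ {a b c b′ c′} → b ℤ.< b′ → (a , b , c) <E (a , b′ , c′)
  <E-third  : ∀ {a b c c′} → c ℤ.< c′ → (a , b , c) <E (a , b , c′)

_≤E_ : Exp → Exp → Set
a ≤E b = a ≡ b ⊎ a <E b

<E-irrefl : ∀ {a} → ¬ (a <E a)
<E-irrefl (<E-first a<a)  = ℤ.<-irrefl refl a<a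
<E-irrefl (<E-second b<b) = ℤ.<-irrefl refl b<b
<E-irrefl (<E-third c<c)  = ℤ.<-irrefl refl c<c

<E-trans : ∀ {a b c} → a <E b → b <E c → a <E c
<E-trans (<E-first p)  (<E-first q)  = <E-first (ℤ.<-trans p q)
<E-trans (<E-first p)  (<E-second _) = <E-first p
<E-trans (<E-first p)  (<E-third _)  = <E-first p
<E-trans (<E-second _) (<E-first q)  = <E-first q
<E-trans (<E-second p) (<E-second q) = <E-second (ℤ.<-trans p q)
<E-trans (<E-second p) (<E-third _)  = <E-second p
<E-trans (<E-third _)  (<E-first q)  = <E-first q
<E-trans (<E-third _)  (<E-second q) = <E-second q
<E-trans (<E-third p)  (<E-third q)  = <E-third (ℤ.<-trans p q)

<E-≤E-trans : ∀ {a b c} → a <E b → b ≤E c → a <E c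
<E-≤E-trans a<b (inj₁ refl) = a<b
<E-≤E-trans a<b (inj₂ b<c)  = <E-trans a<b b<c

≤E-trans : ∀ {a b c} → a ≤E b → b ≤E c → a ≤E c
≤E-trans (inj₁ refl) b≤c = b≤c
≤E-trans (inj₂ a<b)  b≤c = inj₂ (<E-≤E-trans a<b b≤c)

<E-or-≥E : ∀ a b → a <E b ⊎ b ≤E a
<E-or-≥E (a , b , c) (a′ , b′ , c′) with ℤ.<-cmp a a′
... | tri< p _ _ = inj₁ (<E-first p)
... | tri> _ _ p = inj₂ (inj₂ (<E-first p))
... | tri≈ _ refl _ with ℤ.<-cmp b b′
...   | tri< p _ _ = inj₁ (<E-second p)
...   | tri> _ _ p = inj₂ (inj₂ (<E-second p))
...   | tri≈ _ refl _ with ℤ.<-cmp c c′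
...     | tri< p _ _    = inj₁ (<E-third p)
...     | tri> _ _ p    = inj₂ (inj₂ (<E-third p))
...     | tri≈ _ refl _ = inj₂ (inj₁ refl)

addE-monoˡ-<E : ∀ {a b} c → a <E b → addE a c <E addE b c
addE-monoˡ-<E (x , y , z) (<E-first p)  = <E-first (ℤ.+-monoˡ-< x p)
addE-monoˡ-<E (x , y , z) (<E-second p) = <E-second (ℤ.+-monoˡ-< y p)
addE-monoˡ-<E (x , y , z) (<E-third p)  = <E-third (ℤ.+-monoˡ-< z p)

addE-monoʳ-<E : ∀ {a b} c → a <E b → addE c a <E addE c b
addE-monoʳ-<E {a} {b} c a<b rewrite addE-comm c a | addE-comm c b = addE-monoˡ-<E c a<b

addE-mono-≤E-<E : ∀ {a b c d} → a ≤E b → c <E d → addE a c <E addE b d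
addE-mono-≤E-<E {a} (inj₁ refl) c<d = addE-monoʳ-<E a c<d
addE-mono-≤E-<E {b = b} {c} (inj₂ a<b) c<d = <E-trans (addE-monoˡ-<E c a<b) (addE-monoʳ-<E b c<d)

maximum : {P : Exp → Set} → Decidable P → ∀ {s} → P s → (es : List Exp) →
          Σ Exp λ L → P L × s ≤E L × All (λ e → P e → e ≤E L) es
maximum P? {s} Ps [] = s , Ps , inj₁ refl , []
maximum P? {s} Ps (e ∷ es) with P? e | <E-or-≥E s e
... | yes Pe | inj₁ s<e =
  let L , PL , e≤L , bound = maximum P? Pe es
  in L , PL , inj₂ (<E-≤E-trans s<e e≤L) , (λ _ → e≤L) ∷ bound
... | yes Pe | inj₂ e≤s =
  let L , PL , s≤L , bound = maximum P? Ps es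
  in L , PL , s≤L , (λ _ → ≤E-trans e≤s s≤L) ∷ bound
... | no ¬Pe | _ =
  let L , PL , s≤L , bound = maximum P? Ps es
  in L , PL , s≤L , (λ Pe → contradiction Pe ¬Pe) ∷ bound

NonZeroAt : Poly → Exp → Set
NonZeroAt p e = ¬ (coeff p e ≡ 0ℤ)

NonZeroAt⇒∈ : ∀ p {e} → NonZeroAt p e → e ∈ map proj₂ p
NonZeroAt⇒∈ []             p≢0 = contradiction refl p≢0
NonZeroAt⇒∈ ((c , e′) ∷ p) {e} p≢0 with eqE e′ e | eqE-reflects e′ e
... | true  | ofʸ refl = here refl
... | false | ofⁿ _    = there (NonZeroAt⇒∈ p (p≢0 ∘ trans (ℤ.+-identityˡ (coeff p e))))

IsLeadingExp : Poly → Exp → Set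
IsLeadingExp p L = NonZeroAt p L × (∀ e → NonZeroAt p e → e ≤E L)

leadingExp : ∀ p → NonZeroP p → Σ Exp (IsLeadingExp p)
leadingExp p (e , p≢0) =
  let L , pL , _ , bound = maximum (λ e → ¬? (coeff p e ℤ.≟ 0ℤ)) p≢0 (map proj₂ p)
  in L , pL , λ e p≢0 → All.lookup bound (NonZeroAt⇒∈ p p≢0) p≢0

removeExp : Exp → Poly → Poly
removeExp b []            = []
removeExp b ((c , e) ∷ r) = if eqE e b then removeExp b r else (c , e) ∷ removeExp b r

length-removeExp : ∀ b r → length (removeExp b r) ℕ.≤ length r
length-removeExp b []            = ℕ.z≤n
length-removeExp b ((c , e) ∷ r) with eqE e b
... | true  = ℕ.m≤n⇒m≤1+n (length-removeExp b r)
... | false = ℕ.s≤s (length-removeExp b r)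

sumWith-removeExp : ∀ b r k → sumWith r k ≡ coeff r b ℤ.* k b ℤ.+ sumWith (removeExp b r) k
sumWith-removeExp b []            k = refl
sumWith-removeExp b ((c , e) ∷ r) k with eqE e b | eqE-reflects e b
... | true  | ofʸ refl rewrite sumWith-removeExp e r k =
  solve 4 (λ c x a s → c :* x :+ (a :* x :+ s) := (c :+ a) :* x :+ s) refl c (k e) (coeff r e) (sumWith (removeExp e r) k)
  where open +-*-Solver
... | false | ofⁿ _ rewrite sumWith-removeExp b r k =
  solve 5 (λ c y a x s → c :* y :+ (a :* x :+ s) := (con 0ℤ :+ a) :* x :+ (c :* y :+ s))
    refl c (k e) (coeff r b) (k b) (sumWith (removeExp b r) k)
  where open +-*-Solver

coeff-removeExp-≡ : ∀ b r → coeff (removeExp b r) b ≡ 0ℤ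
coeff-removeExp-≡ b []            = refl
coeff-removeExp-≡ b ((c , e) ∷ r) with eqE e b in e≟b
... | true  = coeff-removeExp-≡ b r
... | false rewrite e≟b = trans (ℤ.+-identityˡ _) (coeff-removeExp-≡ b r)

coeff-removeExp-≢ : ∀ b r {b′} → ¬ (b′ ≡ b) → coeff (removeExp b r) b′ ≡ coeff r b′
coeff-removeExp-≢ b []            b′≢b = refl
coeff-removeExp-≢ b ((c , e) ∷ r) {b′} b′≢b with eqE e b | eqE-reflects e b
... | true  | ofʸ refl with eqE e b′ | eqE-reflects e b′
...   | true  | ofʸ refl = contradiction refl b′≢b
...   | false | ofⁿ _    = trans (coeff-removeExp-≢ e r b′≢b) (sym (ℤ.+-identityˡ _))
coeff-removeExp-≢ b ((c , e) ∷ r) {b′} b′≢b | false | ofⁿ _ =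
  cong (λ x → (if eqE e b′ then c else 0ℤ) ℤ.+ x) (coeff-removeExp-≢ b r b′≢b)

-- A Poly may repeat an exponent, so the induction removes all terms of one exponent at a time.
sumWith-cong-support : ∀ r {k k′} → (∀ b → NonZeroAt r b → k b ≡ k′ b) → sumWith r k ≡ sumWith r k′
sumWith-cong-support r = go (length r) r ℕ.≤-refl
  where
  go : ∀ n r {k k′} → length r ℕ.≤ n → (∀ b → NonZeroAt r b → k b ≡ k′ b) → sumWith r k ≡ sumWith r k′
  go n       []            _ _ = refl
  go (suc n) ((c , e) ∷ r) {k} {k′} (ℕ.s≤s len) k≗k′ = begin
    sumWith r′ k                            ≡⟨ sumWith-removeExp e r′ k ⟩
    coeff r′ e ℤ.* k e ℤ.+ sumWith r″ k     ≡⟨ cong₂ ℤ._+_ head (go n r″ len″ k≗k′″) ⟩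
    coeff r′ e ℤ.* k′ e ℤ.+ sumWith r″ k′   ≡⟨ sumWith-removeExp e r′ k′ ⟨
    sumWith r′ k′                           ∎
    where
    open ≡-Reasoning
    r′ r″ : Poly
    r′ = (c , e) ∷ r
    r″ = removeExp e r′
    head : coeff r′ e ℤ.* k e ≡ coeff r′ e ℤ.* k′ e
    head with coeff r′ e ℤ.≟ 0ℤ
    ... | yes r′≡0 rewrite r′≡0 = refl
    ... | no  r′≢0 = cong (coeff r′ e ℤ.*_) (k≗k′ e r′≢0)
    len″ : length r″ ℕ.≤ n
    len″ rewrite eqE-refl e = ℕ.≤-trans (length-removeExp e r) len
    k≗k′″ : ∀ b → NonZeroAt r″ b → k b ≡ k′ b
    k≗k′″ b r″≢0 with b ≟E e
    ... | yes refl = contradiction (coeff-removeExp-≡ b r′) r″≢0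
    ... | no  b≢e  = k≗k′ b (r″≢0 ∘ trans (coeff-removeExp-≢ e r′ b≢e))

coeff-*P-leading : ∀ p r {Lp Lr} → IsLeadingExp p Lp → IsLeadingExp r Lr →
                   coeff (p *P r) (addE Lp Lr) ≡ coeff p Lp ℤ.* coeff r Lr
coeff-*P-leading p r {Lp} {Lr} (_ , p≤Lp) (_ , r≤Lr) = begin
  coeff (p *P r) E                        ≡⟨ coeff-*Pʳ p r E ⟩
  sumWith r (λ b → coeff p (subE E b))    ≡⟨ sumWith-cong-support r onSupport ⟩
  sumWith r (λ b → K ℤ.* δ Lr b)          ≡⟨ sumWith-*ˡ r K (δ Lr) ⟩
  K ℤ.* sumWith r (δ Lr)                  ≡⟨ cong (K ℤ.*_) (coeff≡sumWith-δ r Lr) ⟨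
  K ℤ.* coeff r Lr                        ∎
  where
  open ≡-Reasoning
  E : Exp
  E = addE Lp Lr
  K : ℤ
  K = coeff p Lp
  onSupport : ∀ b → NonZeroAt r b → coeff p (subE E b) ≡ K ℤ.* δ Lr b
  onSupport b r≢0 with eqE b Lr | eqE-reflects b Lr
  ... | true  | ofʸ refl = trans (cong (coeff p) (sym (addE≡⇒≡subE (addE-comm b Lp)))) (sym (ℤ.*-identityʳ K))
  ... | false | ofⁿ b≢Lr with coeff p (subE E b) ℤ.≟ 0ℤ
  ...   | yes p≡0 = trans p≡0 (sym (ℤ.*-zeroʳ K))
  ...   | no  p≢0 = contradiction (addE-mono-≤E-<E (p≤Lp _ p≢0) b<Lr) E≮E
    where
    b<Lr : b <E Lr
    b<Lr = [ (λ b≡Lr → contradiction b≡Lr b≢Lr) , id ]′ (r≤Lr b r≢0)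
    E≮E : ¬ (addE (subE E b) b <E E)
    E≮E rewrite addE-comm (subE E b) b | addE-subE b E = <E-irrefl

*P-nonZero : ∀ p r → NonZeroP p → NonZeroP r → NonZeroP (p *P r)
*P-nonZero p r p≢0 r≢0 with leadingExp p p≢0 | leadingExp r r≢0
... | Lp , lead-p | Lr , lead-r = addE Lp Lr , λ pr≡0 →
  [ proj₁ lead-p , proj₁ lead-r ]′
    (ℤ.i*j≡0⇒i≡0∨j≡0 (coeff p Lp) (trans (sym (coeff-*P-leading p r lead-p lead-r)) pr≡0))

*P-cancelʳ : ∀ a b c → (a *P c) ≈P (b *P c) → NonZeroP c → a ≈P b
*P-cancelʳ a b c ac≈bc c≢0 e with coeff a e ℤ.≟ coeff b e
... | yes a≡b = a≡b
... | no  a≢b = contradiction (dc≈0 (proj₁ dc≢0)) (proj₂ dc≢0)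
  where
  open PolySolver
  open ≈P-Reasoning
  d : Poly
  d = a -P b
  d≢0 : NonZeroP d
  d≢0 = e , λ d≡0 → a≢b (ℤ.i-j≡0⇒i≡j _ _ (trans (sym (coeff--P a b e)) d≡0))
  dc≢0 : NonZeroP (d *P c)
  dc≢0 = *P-nonZero d c d≢0 c≢0
  dc≈0 : (d *P c) ≈P []
  dc≈0 = begin
    d *P c                     ≈⟨ solve 3 (λ a b c → (a :- b) :* c := a :* c :- b :* c) (λ _ → refl) a b c ⟩
    (a *P c) -P (b *P c)       ≈⟨ +P-cong {a *P c} {b *P c} {negP (b *P c)} {negP (b *P c)} ac≈bc (λ _ → refl) ⟩
    (b *P c) -P (b *P c)       ≈⟨ negP-inverseʳ (b *P c) ⟩
    []                         ∎

≈F-trans : ∀ x y z → NonZeroP (den y) → x ≈F y → y ≈F z → x ≈F z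
≈F-trans (a / b) (c / d) (e / f) d≢0 x≈y y≈z = *P-cancelʳ (a *P f) (e *P b) d adf≈ebd d≢0
  where
  open PolySolver
  open ≈P-Reasoning
  adf≈ebd : ((a *P f) *P d) ≈P ((e *P b) *P d)
  adf≈ebd = begin
    (a *P f) *P d  ≈⟨ solve 3 (λ a f d → (a :* f) :* d := (a :* d) :* f) (λ _ → refl) a f d ⟩
    (a *P d) *P f  ≈⟨ *P-congʳ f (a *P d) (c *P b) x≈y ⟩
    (c *P b) *P f  ≈⟨ solve 3 (λ c b f → (c :* b) :* f := (c :* f) :* b) (λ _ → refl) c b f ⟩
    (c *P f) *P b  ≈⟨ *P-congʳ b (c *P f) (e *P d) y≈z ⟩
    (e *P d) *P b  ≈⟨ solve 3 (λ e d b → (e :* d) :* b := (e :* b) :* d) (λ _ → refl) e d b ⟩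
    (e *P b) *P d  ∎

+F-cong : ∀ {x x′ y y′} → x ≈F x′ → y ≈F y′ → (x +F y) ≈F (x′ +F y′)
+F-cong {a / b} {a′ / b′} {c / d} {c′ / d′} x≈x′ y≈y′ = begin
  ((a *P d) +P (c *P b)) *P (b′ *P d′)
    ≈⟨ solve 6 (λ a b c d b′ d′ → ((a :* d) :+ (c :* b)) :* (b′ :* d′) := (a :* b′) :* (d :* d′) :+ (c :* d′) :* (b :* b′))
         (λ _ → refl) a b c d b′ d′ ⟩
  ((a *P b′) *P (d *P d′)) +P ((c *P d′) *P (b *P b′))
    ≈⟨ +P-cong {(a *P b′) *P (d *P d′)} {(a′ *P b) *P (d *P d′)} {(c *P d′) *P (b *P b′)} {(c′ *P d) *P (b *P b′)}
         (*P-congʳ (d *P d′) (a *P b′) (a′ *P b) x≈x′) (*P-congʳ (b *P b′) (c *P d′) (c′ *P d) y≈y′) ⟩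
  ((a′ *P b) *P (d *P d′)) +P ((c′ *P d) *P (b *P b′))
    ≈⟨ solve 6 (λ a′ b c′ d b′ d′ → (a′ :* b) :* (d :* d′) :+ (c′ :* d) :* (b :* b′) := ((a′ :* d′) :+ (c′ :* b′)) :* (b :* d))
         (λ _ → refl) a′ b c′ d b′ d′ ⟩
  ((a′ *P d′) +P (c′ *P b′)) *P (b *P d) ∎
  where
  open PolySolver
  open ≈P-Reasoning

*F-cong : ∀ {x x′ y y′} → x ≈F x′ → y ≈F y′ → (x *F y) ≈F (x′ *F y′)
*F-cong {a / b} {a′ / b′} {c / d} {c′ / d′} x≈x′ y≈y′ = begin
  (a *P c) *P (b′ *P d′)  ≈⟨ solve 6 (λ a b c d b′ d′ → (a :* c) :* (b′ :* d′) := (a :* b′) :* (c :* d′)) (λ _ → refl) a b c d b′ d′ ⟩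
  (a *P b′) *P (c *P d′)  ≈⟨ *P-cong {a *P b′} {a′ *P b} {c *P d′} {c′ *P d} x≈x′ y≈y′ ⟩
  (a′ *P b) *P (c′ *P d)  ≈⟨ solve 6 (λ a′ b c′ d b′ d′ → (a′ :* b) :* (c′ :* d) := (a′ :* c′) :* (b :* d)) (λ _ → refl) a′ b c′ d b′ d′ ⟩
  (a′ *P c′) *P (b *P d)  ∎
  where
  open PolySolver
  open ≈P-Reasoning

+F-assoc : ∀ x y z → ((x +F y) +F z) ≈F (x +F (y +F z))
+F-assoc (a / b) (c / d) (e / f) =
  solve 6 (λ a b c d e f → ((a :* d :+ c :* b) :* f :+ e :* (b :* d)) :* (b :* (d :* f))
                         := (a :* (d :* f) :+ (c :* f :+ e :* d) :* b) :* ((b :* d) :* f)) (λ _ → refl) a b c d e f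
  where open PolySolver

+F-comm : ∀ x y → (x +F y) ≈F (y +F x)
+F-comm (a / b) (c / d) =
  solve 4 (λ a b c d → (a :* d :+ c :* b) :* (d :* b) := (c :* b :+ a :* d) :* (b :* d)) (λ _ → refl) a b c d
  where open PolySolver

+F-identityˡ : ∀ x → (zeroF +F x) ≈F x
+F-identityˡ (a / b) = solve 2 (λ a b → (a :* con 1ℤ) :* b := a :* (con 1ℤ :* b)) (λ _ → refl) a b
  where open PolySolver

+F-identityʳ : ∀ x → (x +F zeroF) ≈F x
+F-identityʳ (a / b) rewrite List.++-identityʳ (a *P oneP) =
  solve 2 (λ a b → (a :* con 1ℤ) :* b := a :* (b :* con 1ℤ)) (λ _ → refl) a b
  where open PolySolver

*F-assoc : ∀ x y z → ((x *F y) *F z) ≈F (x *F (y *F z))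
*F-assoc (a / b) (c / d) (e / f) =
  solve 6 (λ a b c d e f → ((a :* c) :* e) :* (b :* (d :* f)) := (a :* (c :* e)) :* ((b :* d) :* f)) (λ _ → refl) a b c d e f
  where open PolySolver

*F-comm : ∀ x y → (x *F y) ≈F (y *F x)
*F-comm (a / b) (c / d) = solve 4 (λ a b c d → (a :* c) :* (d :* b) := (c :* a) :* (b :* d)) (λ _ → refl) a b c d
  where open PolySolver

*F-identityˡ : ∀ x → (oneF *F x) ≈F x
*F-identityˡ (a / b) = solve 2 (λ a b → (con 1ℤ :* a) :* b := a :* (con 1ℤ :* b)) (λ _ → refl) a b
  where open PolySolver

*F-identityʳ : ∀ x → (x *F oneF) ≈F x
*F-identityʳ (a / b) = solve 2 (λ a b → (a :* con 1ℤ) :* b := a :* (b :* con 1ℤ)) (λ _ → refl) a b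
  where open PolySolver

*F-distribˡ : ∀ x y z → (x *F (y +F z)) ≈F ((x *F y) +F (x *F z))
*F-distribˡ (a / b) (c / d) (e / f) =
  solve 6 (λ a b c d e f → (a :* (c :* f :+ e :* d)) :* ((b :* d) :* (b :* f))
                         := ((a :* c) :* (b :* f) :+ (a :* e) :* (b :* d)) :* (b :* (d :* f))) (λ _ → refl) a b c d e f
  where open PolySolver

*F-distribʳ : ∀ x y z → ((y +F z) *F x) ≈F ((y *F x) +F (z *F x))
*F-distribʳ (a / b) (c / d) (e / f) =
  solve 6 (λ a b c d e f → ((c :* f :+ e :* d) :* a) :* ((d :* b) :* (f :* b))
                         := ((c :* a) :* (f :* b) :+ (e :* a) :* (d :* b)) :* ((d :* f) :* b)) (λ _ → refl) a b c d e f
  where open PolySolver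

*F-zeroˡ : ∀ x → (zeroF *F x) ≈F zeroF
*F-zeroˡ x e = refl

*F-zeroʳ : ∀ x → (x *F zeroF) ≈F zeroF
*F-zeroʳ (a / b) e = trans (*P-identityʳ (a *P []) e) (coeff-*Pʳ a [] e)

Fraction : Set
Fraction = Σ Frac (NonZeroP ∘ den)

oneP-nonZero : NonZeroP oneP
oneP-nonZero = 0E , λ ()

Fraction-commutativeSemiring : CommutativeSemiring 0ℓ 0ℓ
Fraction-commutativeSemiring = record
  { Carrier = Fraction
  ; _≈_ = λ x y → proj₁ x ≈F proj₁ y
  ; _+_ = λ { (x , x≢0) (y , y≢0) → x +F y , *P-nonZero (den x) (den y) x≢0 y≢0 }
  ; _*_ = λ { (x , x≢0) (y , y≢0) → x *F y , *P-nonZero (den x) (den y) x≢0 y≢0 }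
  ; 0# = zeroF , oneP-nonZero
  ; 1# = oneF , oneP-nonZero
  ; isCommutativeSemiring = record
    { isSemiring = record
      { isSemiringWithoutAnnihilatingZero = record
        { +-isCommutativeMonoid = record
          { isMonoid = record
            { isSemigroup = record
              { isMagma = record
                { isEquivalence = record
                  { refl  = λ _ → refl
                  ; sym   = λ x≈y e → sym (x≈y e)
                  ; trans = λ { {x} {y , y≢0} {z} → ≈F-trans (proj₁ x) y (proj₁ z) y≢0 }
                  }
                ; ∙-cong = λ {x x′ y y′} → +F-cong {proj₁ x} {proj₁ x′} {proj₁ y} {proj₁ y′}
                }
              ; assoc = λ x y z → +F-assoc (proj₁ x) (proj₁ y) (proj₁ z)
              }
            ; identity = (λ x → +F-identityˡ (proj₁ x)) , (λ x → +F-identityʳ (proj₁ x))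
            }
          ; comm = λ x y → +F-comm (proj₁ x) (proj₁ y)
          }
        ; *-cong = λ {x x′ y y′} → *F-cong {proj₁ x} {proj₁ x′} {proj₁ y} {proj₁ y′}
        ; *-assoc = λ x y z → *F-assoc (proj₁ x) (proj₁ y) (proj₁ z)
        ; *-identity = (λ x → *F-identityˡ (proj₁ x)) , (λ x → *F-identityʳ (proj₁ x))
        ; distrib = (λ x y z → *F-distribˡ (proj₁ x) (proj₁ y) (proj₁ z)) , (λ x y z → *F-distribʳ (proj₁ x) (proj₁ y) (proj₁ z))
        }
      ; zero = (λ x → *F-zeroˡ (proj₁ x)) , (λ x → *F-zeroʳ (proj₁ x))
      }
    ; *-comm = λ x y → *F-comm (proj₁ x) (proj₁ y)
    }
  }

-- The factor t/(t − u) − t/(t − v) under t ↦ M/t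

-P-inverses : ∀ a a⁻ b b⁻ → (a *P a⁻) ≈P oneP → (b *P b⁻) ≈P oneP → (a⁻ -P b⁻) ≈P ((a⁻ *P b⁻) *P (b -P a))
-P-inverses a a⁻ b b⁻ aa⁻≈1 bb⁻≈1 = begin
  a⁻ -P b⁻                                    ≈⟨ solve 2 (λ x y → x :- y := x :* con 1ℤ :- y :* con 1ℤ) (λ _ → refl) a⁻ b⁻ ⟩
  (a⁻ *P oneP) -P (b⁻ *P oneP)                ≈⟨ -P-cong (a⁻ *P oneP) (a⁻ *P (b *P b⁻)) (b⁻ *P oneP) (b⁻ *P (a *P a⁻))
                                                   (*P-congˡ a⁻ oneP (b *P b⁻) (sym ∘ bb⁻≈1))
                                                   (*P-congˡ b⁻ oneP (a *P a⁻) (sym ∘ aa⁻≈1)) ⟩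
  (a⁻ *P (b *P b⁻)) -P (b⁻ *P (a *P a⁻))      ≈⟨ solve 4 (λ a a⁻ b b⁻ → a⁻ :* (b :* b⁻) :- b⁻ :* (a :* a⁻) := (a⁻ :* b⁻) :* (b :- a))
                                                   (λ _ → refl) a a⁻ b b⁻ ⟩
  (a⁻ *P b⁻) *P (b -P a)                      ∎
  where
  open PolySolver
  open ≈P-Reasoning

factor-reflect : ∀ t u v t⁻ u⁻ v⁻ M → (t *P t⁻) ≈P oneP → (u *P u⁻) ≈P oneP → (v *P v⁻) ≈P oneP →
                 factor t u v ≈F factor (M *P t⁻) (M *P v⁻) (M *P u⁻)
factor-reflect t u v t⁻ u⁻ v⁻ M tt⁻≈1 uu⁻≈1 vv⁻≈1 = begin
  num (factor t u v) *P den (factor t′ v′ u′)  ≈⟨ left≈X ⟩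
  X                                            ≈⟨ right≈X ⟨
  num (factor t′ v′ u′) *P den (factor t u v)  ∎
  where
  open PolySolver
  open ≈P-Reasoning
  t′ u′ v′ P Q X : Poly
  t′ = M *P t⁻
  u′ = M *P u⁻
  v′ = M *P v⁻
  P = (M *P M) *P (t *P (u -P v))
  Q = (M *P M) *P t⁻
  X′ : ∀ {n} → (t u v t⁻ u⁻ v⁻ M : Polynomial n) → Polynomial n
  X′ t u v t⁻ u⁻ v⁻ M = (((M :* M) :* (t⁻ :* (v⁻ :* u⁻))) :* ((u :- v) :* ((t :- u) :* (t :- v))))
  X = ((M *P M) *P (t⁻ *P (v⁻ *P u⁻))) *P ((u -P v) *P ((t -P u) *P (t -P v)))

  left≈X : (num (factor t u v) *P den (factor t′ v′ u′)) ≈P X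
  left≈X = begin
    num (factor t u v) *P den (factor t′ v′ u′)
      ≈⟨ solve 7 (λ t u v t⁻ u⁻ v⁻ M → (t :* (t :- v) :- t :* (t :- u)) :* ((M :* t⁻ :- M :* v⁻) :* (M :* t⁻ :- M :* u⁻))
                                     := ((M :* M) :* (t :* (u :- v))) :* ((t⁻ :- v⁻) :* (t⁻ :- u⁻)))
           (λ _ → refl) t u v t⁻ u⁻ v⁻ M ⟩
    P *P ((t⁻ -P v⁻) *P (t⁻ -P u⁻))
      ≈⟨ *P-congˡ P ((t⁻ -P v⁻) *P (t⁻ -P u⁻)) (((t⁻ *P v⁻) *P (v -P t)) *P ((t⁻ *P u⁻) *P (u -P t)))
           (*P-cong {t⁻ -P v⁻} {(t⁻ *P v⁻) *P (v -P t)} {t⁻ -P u⁻} {(t⁻ *P u⁻) *P (u -P t)}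
             (-P-inverses t t⁻ v v⁻ tt⁻≈1 vv⁻≈1) (-P-inverses t t⁻ u u⁻ tt⁻≈1 uu⁻≈1)) ⟩
    P *P (((t⁻ *P v⁻) *P (v -P t)) *P ((t⁻ *P u⁻) *P (u -P t)))
      ≈⟨ solve 7 (λ t u v t⁻ u⁻ v⁻ M → ((M :* M) :* (t :* (u :- v))) :* (((t⁻ :* v⁻) :* (v :- t)) :* ((t⁻ :* u⁻) :* (u :- t)))
                                     := X′ t u v t⁻ u⁻ v⁻ M :* (t :* t⁻))
           (λ _ → refl) t u v t⁻ u⁻ v⁻ M ⟩
    X *P (t *P t⁻)  ≈⟨ *P-congˡ X (t *P t⁻) oneP tt⁻≈1 ⟩
    X *P oneP       ≈⟨ *P-identityʳ X ⟩
    X               ∎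

  right≈X : (num (factor t′ v′ u′) *P den (factor t u v)) ≈P X
  right≈X = begin
    num (factor t′ v′ u′) *P den (factor t u v)
      ≈⟨ solve 7 (λ t u v t⁻ u⁻ v⁻ M → ((M :* t⁻) :* (M :* t⁻ :- M :* u⁻) :- (M :* t⁻) :* (M :* t⁻ :- M :* v⁻)) :* ((t :- u) :* (t :- v))
                                     := (((M :* M) :* t⁻) :* (v⁻ :- u⁻)) :* ((t :- u) :* (t :- v)))
           (λ _ → refl) t u v t⁻ u⁻ v⁻ M ⟩
    (Q *P (v⁻ -P u⁻)) *P ((t -P u) *P (t -P v))
      ≈⟨ *P-congʳ ((t -P u) *P (t -P v)) (Q *P (v⁻ -P u⁻)) (Q *P ((v⁻ *P u⁻) *P (u -P v)))
           (*P-congˡ Q (v⁻ -P u⁻) ((v⁻ *P u⁻) *P (u -P v)) (-P-inverses v v⁻ u u⁻ vv⁻≈1 uu⁻≈1)) ⟩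
    (Q *P ((v⁻ *P u⁻) *P (u -P v))) *P ((t -P u) *P (t -P v))
      ≈⟨ solve 7 (λ t u v t⁻ u⁻ v⁻ M → ((M :* M) :* t⁻) :* ((v⁻ :* u⁻) :* (u :- v)) :* ((t :- u) :* (t :- v))
                                     := X′ t u v t⁻ u⁻ v⁻ M)
           (λ _ → refl) t u v t⁻ u⁻ v⁻ M ⟩
    X ∎

monomial : Exp → Poly
monomial e = (1ℤ , e) ∷ []

monomial-inverse : ∀ a → (monomial a *P monomial (negE a)) ≈P oneP
monomial-inverse a e = cong (λ x → coeff (monomial x) e) (addE-inverseʳ a)

monomial-difference-nonZero : ∀ {et eu} → ¬ (eu ≡ et) → NonZeroP (monomial et -P monomial eu)
monomial-difference-nonZero {et} {eu} eu≢et = et , λ coeff≡0 → contradiction (trans (sym coeff≡1) coeff≡0) λ ()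
  where
  coeff≡1 : coeff (monomial et -P monomial eu) et ≡ + 1
  coeff≡1 rewrite eqE-refl et with eqE eu et | eqE-reflects eu et
  ... | true  | ofʸ eu≡et = contradiction eu≡et eu≢et
  ... | false | ofⁿ _     = refl

factor-reflect-monomial : ∀ M et eu ev →
  factor (monomial et) (monomial eu) (monomial ev) ≈F
  factor (monomial (subE M et)) (monomial (subE M ev)) (monomial (subE M eu))
factor-reflect-monomial M et eu ev =
  factor-reflect (monomial et) (monomial eu) (monomial ev) (monomial (negE et)) (monomial (negE eu)) (monomial (negE ev))
    (monomial M) (monomial-inverse et) (monomial-inverse eu) (monomial-inverse ev)

-- Nested sums over chains and their reflection

range-≤ : ∀ {lo hi} → lo ≤ hi → range lo hi ≡ lo ∷ range (suc lo) hi
range-≤ {lo} {hi} lo≤hi rewrite ℕ.+-∸-assoc 1 lo≤hi =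
  cong₂ _∷_ (ℕ.+-identityʳ lo) (shift (hi ∸ lo) suc (λ i → i) (λ _ → refl))
  where
  shift : ∀ k (g h : ℕ → ℕ) → (∀ i → g i ≡ suc (h i)) →
          map (lo ℕ.+_) (applyUpTo g k) ≡ map (suc lo ℕ.+_) (applyUpTo h k)
  shift zero    g h g≡1+h = refl
  shift (suc k) g h g≡1+h =
    cong₂ _∷_ (trans (cong (lo ℕ.+_) (g≡1+h 0)) (ℕ.+-suc lo _)) (shift k (g ∘′ suc) (h ∘′ suc) (λ i → g≡1+h (suc i)))

range-bounded : ∀ lo N → All (_≤ N) (range lo N)
range-bounded lo N = All-map⁺ (applyUpTo⁺₁ id (suc N ∸ lo) lo+i≤N)
  where
  lo+i≤N : ∀ {i} → i < suc N ∸ lo → lo ℕ.+ i ≤ N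
  lo+i≤N i<1+N∸lo = ℕ.≤-pred (ℕ.<-≤-trans (ℕ.+-monoʳ-< lo i<1+N∸lo) (ℕ.≤-reflexive (ℕ.m+[n∸m]≡n lo≤1+N)))
    where
    lo≤1+N : lo ≤ suc N
    lo≤1+N = ℕ.<⇒≤ (ℕ.m∸n≢0⇒n<m (ℕ.m<n⇒n≢0 i<1+N∸lo))

∸-reflect : ∀ {lo len lo′ M} → lo ℕ.+ suc len ℕ.+ lo′ ≡ suc M → lo ≡ M ∸ (lo′ ℕ.+ len)
∸-reflect {lo} {len} {lo′} {M} window = sym (begin
  M ∸ (lo′ ℕ.+ len)                     ≡⟨ cong (_∸ (lo′ ℕ.+ len)) (ℕ.suc-injective (trans (sym window) (shuffle lo len lo′))) ⟩
  lo ℕ.+ (lo′ ℕ.+ len) ∸ (lo′ ℕ.+ len)  ≡⟨ ℕ.m+n∸n≡m lo (lo′ ℕ.+ len) ⟩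
  lo                                    ∎)
  where
  open ≡-Reasoning
  open NatSolver.+-*-Solver
  shuffle : ∀ a b c → a ℕ.+ suc b ℕ.+ c ≡ suc (a ℕ.+ (c ℕ.+ b))
  shuffle = solve 3 (λ a b c → a :+ (con 1 :+ b) :+ c := con 1 :+ (a :+ (c :+ b))) refl

module ChainSums {r ℓ} (R : CommutativeSemiring r ℓ) where
  open CommutativeSemiring R hiding (zero) renaming (refl to ≈-refl; sym to ≈-sym; trans to ≈-trans)
  open import Algebra.Solver.Ring.NaturalCoefficients.Default R
  open SetoidReasoning setoid

  chainSum : List (ℕ → Carrier) → ℕ → ℕ → Carrier
  chainSum []       lo hi = 1#
  chainSum (f ∷ fs) lo hi = foldr _+_ 0# (map (λ n → f n * chainSum fs n hi) (range lo hi))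

  -- The same sum with the chains confined to the window lo ≤ n < lo + len.
  windowSum : List (ℕ → Carrier) → ℕ → ℕ → Carrier
  windowSum []       lo len       = 1#
  windowSum (f ∷ fs) lo zero      = 0#
  windowSum (f ∷ fs) lo (suc len) = f lo * windowSum fs lo (suc len) + windowSum (f ∷ fs) (suc lo) len

  chainSum-∷ : ∀ f fs {lo hi} → lo ≤ hi → chainSum (f ∷ fs) lo hi ≡ f lo * chainSum fs lo hi + chainSum (f ∷ fs) (suc lo) hi
  chainSum-∷ f fs {hi = hi} lo≤hi = cong (foldr _+_ 0# ∘′ map (λ n → f n * chainSum fs n hi)) (range-≤ lo≤hi)

  chainSum≈windowSum : ∀ fs len {lo hi} → suc hi ∸ lo ≡ len → chainSum fs lo hi ≈ windowSum fs lo len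
  chainSum≈windowSum []       len       _ = ≈-refl
  chainSum≈windowSum (f ∷ fs) zero      1+hi∸lo≡0 rewrite 1+hi∸lo≡0 = ≈-refl
  chainSum≈windowSum (f ∷ fs) (suc len) {lo} {hi} 1+hi∸lo≡1+len = ≈-trans (reflexive (chainSum-∷ f fs lo≤hi)) (+-cong
    (*-cong ≈-refl (chainSum≈windowSum fs (suc len) 1+hi∸lo≡1+len))
    (chainSum≈windowSum (f ∷ fs) len (ℕ.suc-injective (trans (sym (ℕ.+-∸-assoc 1 lo≤hi)) 1+hi∸lo≡1+len))))
    where
    lo≤hi : lo ≤ hi
    lo≤hi = ℕ.≤-pred (ℕ.m∸n≢0⇒n<m (λ 1+hi∸lo≡0 → contradiction (trans (sym 1+hi∸lo≡0) 1+hi∸lo≡1+len) (λ ())))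

  windowSum-empty : ∀ fs g lo → windowSum (fs ∷ʳ g) lo 0 ≈ 0#
  windowSum-empty []       g lo = ≈-refl
  windowSum-empty (f ∷ fs) g lo = ≈-refl

  windowSum-∷ʳ : ∀ fs g lo len →
    windowSum (fs ∷ʳ g) lo (suc len) ≈ windowSum fs lo (suc len) * g (lo ℕ.+ len) + windowSum (fs ∷ʳ g) lo len
  windowSum-∷ʳ []       g lo zero rewrite ℕ.+-identityʳ lo =
    solve 1 (λ a → a :* con 1 :+ con 0 := con 1 :* a :+ con 0) ≈-refl (g lo)
  windowSum-∷ʳ []       g lo (suc len) = begin
    g lo * 1# + windowSum [ g ] (suc lo) (suc len)
      ≈⟨ +-cong ≈-refl (windowSum-∷ʳ [] g (suc lo) len) ⟩
    g lo * 1# + (1# * g (suc lo ℕ.+ len) + windowSum [ g ] (suc lo) len)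
      ≈⟨ solve 3 (λ a b c → a :* con 1 :+ (con 1 :* b :+ c) := con 1 :* b :+ (a :* con 1 :+ c))
           ≈-refl (g lo) (g (suc lo ℕ.+ len)) (windowSum [ g ] (suc lo) len) ⟩
    1# * g (suc lo ℕ.+ len) + (g lo * 1# + windowSum [ g ] (suc lo) len)
      ≡⟨ cong (λ k → 1# * g k + (g lo * 1# + windowSum [ g ] (suc lo) len)) (sym (ℕ.+-suc lo len)) ⟩
    1# * g (lo ℕ.+ suc len) + (g lo * 1# + windowSum [ g ] (suc lo) len) ∎
  windowSum-∷ʳ (f ∷ fs) g lo zero = begin
    f lo * windowSum (fs ∷ʳ g) lo 1 + 0#
      ≈⟨ +-cong (*-cong ≈-refl (windowSum-∷ʳ fs g lo zero)) ≈-refl ⟩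
    f lo * (windowSum fs lo 1 * g (lo ℕ.+ 0) + windowSum (fs ∷ʳ g) lo 0) + 0#
      ≈⟨ +-cong (*-cong ≈-refl (+-cong ≈-refl (windowSum-empty fs g lo))) ≈-refl ⟩
    f lo * (windowSum fs lo 1 * g (lo ℕ.+ 0) + 0#) + 0#
      ≈⟨ solve 3 (λ a b c → a :* (b :* c :+ con 0) :+ con 0 := (a :* b :+ con 0) :* c :+ con 0)
           ≈-refl (f lo) (windowSum fs lo 1) (g (lo ℕ.+ 0)) ⟩
    (f lo * windowSum fs lo 1 + 0#) * g (lo ℕ.+ 0) + 0# ∎
  windowSum-∷ʳ (f ∷ fs) g lo (suc len) = begin
    f lo * windowSum (fs ∷ʳ g) lo (suc (suc len)) + windowSum (f ∷ fs ∷ʳ g) (suc lo) (suc len)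
      ≈⟨ +-cong (*-cong ≈-refl (windowSum-∷ʳ fs g lo (suc len))) (windowSum-∷ʳ (f ∷ fs) g (suc lo) len) ⟩
    f lo * (a * G + b) + (c * g (suc lo ℕ.+ len) + d)
      ≡⟨ cong (λ k → f lo * (a * G + b) + (c * g k + d)) (sym (ℕ.+-suc lo len)) ⟩
    f lo * (a * G + b) + (c * G + d)
      ≈⟨ solve 6 (λ x a b c d G → x :* (a :* G :+ b) :+ (c :* G :+ d) := (x :* a :+ c) :* G :+ (x :* b :+ d))
           ≈-refl (f lo) a b c d G ⟩
    (f lo * a + c) * G + (f lo * b + d) ∎
    where
    a b c d G : Carrier
    a = windowSum fs lo (suc (suc len))
    b = windowSum (fs ∷ʳ g) lo (suc len)
    c = windowSum (f ∷ fs) (suc lo) (suc len)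
    d = windowSum (f ∷ fs ∷ʳ g) (suc lo) len
    G = g (lo ℕ.+ suc len)

  reflect : ℕ → List (ℕ → Carrier) → List (ℕ → Carrier)
  reflect M fs = reverse (map (λ f n → f (M ∸ n)) fs)

  reflect-∷ : ∀ M f fs → reflect M (f ∷ fs) ≡ reflect M fs ∷ʳ (λ n → f (M ∸ n))
  reflect-∷ M f fs = List.unfold-reverse (λ n → f (M ∸ n)) (map (λ f n → f (M ∸ n)) fs)

  windowSum-reflect : ∀ M fs lo lo′ len → lo ℕ.+ len ℕ.+ lo′ ≡ suc M → windowSum fs lo len ≈ windowSum (reflect M fs) lo′ len
  windowSum-reflect M []       lo lo′ len       _ = ≈-refl
  windowSum-reflect M (f ∷ fs) lo lo′ zero      _ rewrite reflect-∷ M f fs = ≈-sym (windowSum-empty (reflect M fs) _ lo′)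
  windowSum-reflect M (f ∷ fs) lo lo′ (suc len) window = begin
    f lo * windowSum fs lo (suc len) + windowSum (f ∷ fs) (suc lo) len
      ≈⟨ +-cong (*-cong ≈-refl (windowSum-reflect M fs lo lo′ (suc len) window))
                (windowSum-reflect M (f ∷ fs) (suc lo) lo′ len (trans (cong (ℕ._+ lo′) (sym (ℕ.+-suc lo len))) window)) ⟩
    f lo * windowSum (reflect M fs) lo′ (suc len) + windowSum (reflect M (f ∷ fs)) lo′ len
      ≡⟨ cong (λ gs → f lo * windowSum (reflect M fs) lo′ (suc len) + windowSum gs lo′ len) (reflect-∷ M f fs) ⟩
    f lo * windowSum (reflect M fs) lo′ (suc len) + windowSum (reflect M fs ∷ʳ f̃) lo′ len
      ≈⟨ +-cong (*-comm _ _) ≈-refl ⟩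
    windowSum (reflect M fs) lo′ (suc len) * f lo + windowSum (reflect M fs ∷ʳ f̃) lo′ len
      ≡⟨ cong (λ k → windowSum (reflect M fs) lo′ (suc len) * f k + windowSum (reflect M fs ∷ʳ f̃) lo′ len) lo≡M∸[lo′+len] ⟩
    windowSum (reflect M fs) lo′ (suc len) * f̃ (lo′ ℕ.+ len) + windowSum (reflect M fs ∷ʳ f̃) lo′ len
      ≈⟨ windowSum-∷ʳ (reflect M fs) f̃ lo′ len ⟨
    windowSum (reflect M fs ∷ʳ f̃) lo′ (suc len)
      ≡⟨ cong (λ gs → windowSum gs lo′ (suc len)) (reflect-∷ M f fs) ⟨
    windowSum (reflect M (f ∷ fs)) lo′ (suc len) ∎
    where
    f̃ : ℕ → Carrier
    f̃ n = f (M ∸ n)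
    lo≡M∸[lo′+len] : lo ≡ M ∸ (lo′ ℕ.+ len)
    lo≡M∸[lo′+len] = ∸-reflect window

  AgreeBelow : ℕ → (ℕ → Carrier) → (ℕ → Carrier) → Set ℓ
  AgreeBelow K f g = ∀ n → n < K → f n ≈ g n

  windowSum-cong : ∀ {K fs gs} → Pointwise (AgreeBelow K) fs gs →
                   ∀ lo len → lo ℕ.+ len ≤ K → windowSum fs lo len ≈ windowSum gs lo len
  windowSum-cong []            lo len       _ = ≈-refl
  windowSum-cong (f≈g ∷ fs≈gs) lo zero      _ = ≈-refl
  windowSum-cong (f≈g ∷ fs≈gs) lo (suc len) lo+len≤K = +-cong
    (*-cong (f≈g lo (ℕ.<-≤-trans (ℕ.m<m+n lo ℕ.z<s) lo+len≤K)) (windowSum-cong fs≈gs lo (suc len) lo+len≤K))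
    (windowSum-cong (f≈g ∷ fs≈gs) (suc lo) len (ℕ.≤-trans (ℕ.≤-reflexive (sym (ℕ.+-suc lo len))) lo+len≤K))

  chainSum-reflect : ∀ N fs gs → Pointwise (AgreeBelow (suc N)) (reflect N fs) gs → chainSum fs 0 N ≈ chainSum gs 0 N
  chainSum-reflect N fs gs reflect≈gs = begin
    chainSum fs 0 N                      ≈⟨ chainSum≈windowSum fs (suc N) refl ⟩
    windowSum fs 0 (suc N)               ≈⟨ windowSum-reflect N fs 0 0 (suc N) (ℕ.+-identityʳ (suc N)) ⟩
    windowSum (reflect N fs) 0 (suc N)   ≈⟨ windowSum-cong reflect≈gs 0 (suc N) ℕ.≤-refl ⟩
    windowSum gs 0 (suc N)               ≈⟨ chainSum≈windowSum gs (suc N) refl ⟨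
    chainSum gs 0 N                      ∎

τ-++ : ∀ a b → τ (a ++ b) ≡ τ b ++ τ a
τ-++ a b rewrite List.map-++ τℓ a b = List.reverse-++ (map τℓ a) (map τℓ b)

τ-∷ : ∀ ℓ a → τ (ℓ ∷ a) ≡ τ a ∷ʳ τℓ ℓ
τ-∷ ℓ a = List.unfold-reverse (τℓ ℓ) (map τℓ a)

τ-∷ʳ : ∀ a ℓ → τ (a ∷ʳ ℓ) ≡ τℓ ℓ ∷ τ a
τ-∷ʳ a ℓ = τ-++ a [ ℓ ]

positionsIn : Word → Word → Word → List (Letter × Word × Word)
positionsIn pre []      post = []
positionsIn pre (ℓ ∷ w) post = (ℓ , pre ∷ʳ ℓ , ℓ ∷ (w ++ post)) ∷ positionsIn (pre ∷ʳ ℓ) w post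

positions≡positionsIn : ∀ pre w → positions pre w ≡ positionsIn pre w []
positions≡positionsIn pre []      = refl
positions≡positionsIn pre (ℓ ∷ w) =
  cong₂ _∷_ (cong (λ s → ℓ , pre ∷ʳ ℓ , ℓ ∷ s) (sym (List.++-identityʳ w))) (positions≡positionsIn (pre ∷ʳ ℓ) w)

positionsIn-++ : ∀ pre a b post → positionsIn pre (a ++ b) post ≡ positionsIn pre a (b ++ post) ++ positionsIn (pre ++ a) b post
positionsIn-++ pre []      b post rewrite List.++-identityʳ pre = refl
positionsIn-++ pre (ℓ ∷ a) b post = cong₂ _∷_
  (cong (λ s → ℓ , pre ∷ʳ ℓ , ℓ ∷ s) (List.++-assoc a b post))
  (trans (positionsIn-++ (pre ∷ʳ ℓ) a b post)
         (cong (λ p → positionsIn (pre ∷ʳ ℓ) a (b ++ post) ++ positionsIn p b post) (List.++-assoc pre [ ℓ ] a)))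

mirror : Letter × Word × Word → Letter × Word × Word
mirror (ℓ , pre , suf) = τℓ ℓ , τ suf , τ pre

positionsIn-τ : ∀ pre w post → positionsIn (τ post) (τ w) (τ pre) ≡ reverse (map mirror (positionsIn pre w post))
positionsIn-τ pre []      post = refl
positionsIn-τ pre (ℓ ∷ w) post = begin
  positionsIn (τ post) (τ (ℓ ∷ w)) (τ pre)
    ≡⟨ cong (λ v → positionsIn (τ post) v (τ pre)) (τ-∷ ℓ w) ⟩
  positionsIn (τ post) (τ w ∷ʳ τℓ ℓ) (τ pre)
    ≡⟨ positionsIn-++ (τ post) (τ w) [ τℓ ℓ ] (τ pre) ⟩
  positionsIn (τ post) (τ w) (τℓ ℓ ∷ τ pre) ++ [ (τℓ ℓ , (τ post ++ τ w) ∷ʳ τℓ ℓ , τℓ ℓ ∷ τ pre) ]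
    ≡⟨ cong₂ _++_ (trans (cong (positionsIn (τ post) (τ w)) (sym (τ-∷ʳ pre ℓ))) (positionsIn-τ (pre ∷ʳ ℓ) w post))
                  (cong [_] (cong₂ (λ p s → τℓ ℓ , p , s) lastPrefix (sym (τ-∷ʳ pre ℓ)))) ⟩
  reverse (map mirror (positionsIn (pre ∷ʳ ℓ) w post)) ∷ʳ mirror (ℓ , pre ∷ʳ ℓ , ℓ ∷ (w ++ post))
    ≡⟨ List.unfold-reverse _ (map mirror (positionsIn (pre ∷ʳ ℓ) w post)) ⟨
  reverse (map mirror (positionsIn pre (ℓ ∷ w) post)) ∎
  where
  open ≡-Reasoning
  lastPrefix : (τ post ++ τ w) ∷ʳ τℓ ℓ ≡ τ (ℓ ∷ (w ++ post))
  lastPrefix = sym (trans (τ-∷ ℓ (w ++ post)) (cong (_∷ʳ τℓ ℓ) (τ-++ w post)))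

positions-τ : ∀ w → positions [] (τ w) ≡ reverse (map mirror (positions [] w))
positions-τ w = begin
  positions [] (τ w)                            ≡⟨ positions≡positionsIn [] (τ w) ⟩
  positionsIn (τ []) (τ w) (τ [])               ≡⟨ positionsIn-τ [] w [] ⟩
  reverse (map mirror (positionsIn [] w []))    ≡⟨ cong (reverse ∘′ map mirror) (positions≡positionsIn [] w) ⟨
  reverse (map mirror (positions [] w))         ∎
  where open ≡-Reasoning

IsSplitOf : Word → Letter × Word × Word → Set
IsSplitOf w (ℓ , pre , suf) = ∃₂ λ a b → w ≡ a ++ ℓ ∷ b × pre ≡ a ∷ʳ ℓ × suf ≡ ℓ ∷ b

positions-split : ∀ pre w → All (IsSplitOf (pre ++ w)) (positions pre w)
positions-split pre []      = []
positions-split pre (ℓ ∷ w) = (pre , w , refl , refl , refl) ∷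
  subst (λ v → All (IsSplitOf v) (positions (pre ∷ʳ ℓ) w)) (List.++-assoc pre [ ℓ ] w) (positions-split (pre ∷ʳ ℓ) w)

count-++ : ∀ p a b → count p (a ++ b) ≡ count p a ℕ.+ count p b
count-++ p []      b = refl
count-++ p (ℓ ∷ a) b with p ℓ
... | true  = cong suc (count-++ p a b)
... | false = count-++ p a b

count-reverse : ∀ p a → count p (reverse a) ≡ count p a
count-reverse p []      = refl
count-reverse p (ℓ ∷ a) rewrite List.unfold-reverse ℓ a | count-++ p (reverse a) [ ℓ ] | count-reverse p a with p ℓ
... | true  = ℕ.+-comm (count p a) 1
... | false = ℕ.+-identityʳ (count p a)

count-τ : ∀ p q → (∀ ℓ → p (τℓ ℓ) ≡ q ℓ) → ∀ a → count p (τ a) ≡ count q a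
count-τ p q p∘τℓ≗q a = trans (count-reverse p (map τℓ a)) (count-map a)
  where
  count-map : ∀ a → count p (map τℓ a) ≡ count q a
  count-map []      = refl
  count-map (ℓ ∷ a) rewrite p∘τℓ≗q ℓ with q ℓ
  ... | true  = cong suc (count-map a)
  ... | false = count-map a

Partition : (p q r : Letter → Bool) → Set
Partition p q r = ∀ ℓ → (if p ℓ then 1 else 0) ℕ.+ (if q ℓ then 1 else 0) ≡ (if r ℓ then 1 else 0)

count-partition : ∀ {p q r} → Partition p q r → ∀ a → count p a ℕ.+ count q a ≡ count r a
count-partition         split []      = refl
count-partition {p} {q} {r} split (ℓ ∷ a) with p ℓ | q ℓ | r ℓ | split ℓ
... | true  | false | true  | _ = cong suc (count-partition split a)
... | false | true  | true  | _ = trans (ℕ.+-suc (count p a) (count q a)) (cong suc (count-partition split a))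
... | false | false | false | _ = count-partition split a

count-partition-sum : ∀ {p p′ q q′} → Partition p p′ isNotAD → Partition q q′ isNotAD → ∀ pre suf →
                      (count q suf ℕ.+ count p pre) ℕ.+ (count p′ pre ℕ.+ count q′ suf) ≡ count isNotAD pre ℕ.+ count isNotAD suf
count-partition-sum {p} {p′} {q} {q′} split-p split-q pre suf = begin
  (count q suf ℕ.+ count p pre) ℕ.+ (count p′ pre ℕ.+ count q′ suf)
    ≡⟨ solve 4 (λ a b c d → (a :+ b) :+ (c :+ d) := (b :+ c) :+ (a :+ d)) refl (count q suf) (count p pre) (count p′ pre) (count q′ suf) ⟩
  (count p pre ℕ.+ count p′ pre) ℕ.+ (count q suf ℕ.+ count q′ suf)
    ≡⟨ cong₂ ℕ._+_ (count-partition split-p pre) (count-partition split-q suf) ⟩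
  count isNotAD pre ℕ.+ count isNotAD suf ∎
  where
  open ≡-Reasoning
  open NatSolver.+-*-Solver

headOK-map : ∀ {bad bad′ : Letter → Bool} {f : Letter → Letter} →
             (∀ x → bad (f x) ≡ bad′ x) → ∀ xs → headOK bad′ xs → headOK bad (map f xs)
headOK-map bad∘f≗bad′ []       _  = _
headOK-map bad∘f≗bad′ (x ∷ xs) ok rewrite bad∘f≗bad′ x = ok

Admissible-τ : ∀ w → Admissible w → Admissible (τ w)
Admissible-τ w (start , end) =
  subst (headOK badStart) (List.reverse-map τℓ w)
    (headOK-map (λ { eAB → refl ; eAC → refl ; eAD → refl ; eBC → refl ; eBD → refl ; eCD → refl }) (reverse w) end) ,
  subst (headOK badEnd) (sym (List.reverse-involutive (map τℓ w)))
    (headOK-map (λ { eAB → refl ; eAC → refl ; eAD → refl ; eBC → refl ; eBD → refl ; eCD → refl }) w start)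

m-τ : ∀ w → m (τ w) ≡ m w
m-τ w = cong suc (count-τ isNotAD isNotAD (λ { eAB → refl ; eAC → refl ; eAD → refl ; eBC → refl ; eBD → refl ; eCD → refl }) w)

count-prefix-≥1 : ∀ {bad p : Letter → Bool} → (∀ ℓ → T (not (bad ℓ)) → p ℓ ≡ true) →
                  ∀ a ℓ b → headOK bad (a ++ ℓ ∷ b) → 1 ≤ count p (a ∷ʳ ℓ)
count-prefix-≥1 good⇒p []      ℓ b ok rewrite good⇒p ℓ ok = ℕ.s≤s ℕ.z≤n
count-prefix-≥1 good⇒p (x ∷ a) ℓ b ok rewrite good⇒p x ok = ℕ.s≤s ℕ.z≤n

reverse-split : ∀ a (ℓ : Letter) b → reverse (a ++ ℓ ∷ b) ≡ reverse b ++ ℓ ∷ reverse a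
reverse-split a ℓ b = begin
  reverse (a ++ ℓ ∷ b)            ≡⟨ List.reverse-++ a (ℓ ∷ b) ⟩
  reverse (ℓ ∷ b) ++ reverse a    ≡⟨ cong (_++ reverse a) (List.unfold-reverse ℓ b) ⟩
  (reverse b ∷ʳ ℓ) ++ reverse a   ≡⟨ List.++-assoc (reverse b) [ ℓ ] (reverse a) ⟩
  reverse b ++ ℓ ∷ reverse a      ∎
  where open ≡-Reasoning

count-suffix-≥1 : ∀ {bad p : Letter → Bool} → (∀ ℓ → T (not (bad ℓ)) → p ℓ ≡ true) →
                  ∀ a ℓ b → headOK bad (reverse (a ++ ℓ ∷ b)) → 1 ≤ count p (ℓ ∷ b)
count-suffix-≥1 {bad} {p} good⇒p a ℓ b ok =
  subst (1 ≤_) (trans (cong (count p) (sym (List.unfold-reverse ℓ b))) (count-reverse p (ℓ ∷ b)))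
    (count-prefix-≥1 good⇒p (reverse b) ℓ (reverse a) (subst (headOK bad) (reverse-split a ℓ b) ok))

count-isNotAD-split : ∀ a ℓ b → isNotAD ℓ ≡ true → count isNotAD (a ∷ʳ ℓ) ℕ.+ count isNotAD (ℓ ∷ b) ≡ m (a ++ ℓ ∷ b)
count-isNotAD-split a ℓ b ℓ≢AD rewrite count-++ isNotAD a [ ℓ ] | count-++ isNotAD a (ℓ ∷ b) | ℓ≢AD =
  solve 2 (λ x y → (x :+ con 1) :+ (con 1 :+ y) := con 1 :+ (x :+ (con 1 :+ y))) refl (count isNotAD a) (count isNotAD b)
  where open NatSolver.+-*-Solver

-- L_q as a sum over chains

+-minus-+ : ∀ {n k} → k ≤ n → + n ℤ.- + k ≡ + (n ∸ k)
+-minus-+ {n} {k} k≤n = trans (ℤ.m-n≡m⊖n n k) (ℤ.⊖-≥ k≤n)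

positive≢nonpositive : ∀ {c k} → 1 ≤ c → ¬ (+ c ≡ ℤ.- (+ k))
positive≢nonpositive {suc c} {zero}  _ ()
positive≢nonpositive {suc c} {suc k} _ ()

negative≢nonnegative : ∀ {s j} → 1 ≤ s → ¬ (ℤ.- (+ s) ≡ + j)
negative≢nonnegative {suc s} _ ()

pointwise-map : ∀ {A B : Set} {R : B → B → Set} {P : A → Set} (f g : A → B) →
                (∀ {x} → P x → R (f x) (g x)) → ∀ {xs} → All P xs → Pointwise R (map f xs) (map g xs)
pointwise-map f g P⇒R []         = []
pointwise-map f g P⇒R (px ∷ pxs) = P⇒R px ∷ pointwise-map f g P⇒R pxs

module _ (N : ℕ) where

  A : Poly
  A = mono 1ℤ 0ℤ (+ 1) (+ N)

  -- A *P qInv n reduces to monomial (pointE n), the point t = A q^{-n} of the q-integral.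
  pointE : ℕ → Exp
  pointE n = addE (0ℤ , + 1 , + N) (0ℤ , 0ℤ , ℤ.- (+ n))

  -- AD = q^N D²
  ADE : Exp
  ADE = 0ℤ , + 2 , + N

  pointE-reflect : ∀ {n} → n ≤ N → addE (pointE (N ∸ n)) (pointE n) ≡ ADE
  pointE-reflect {n} n≤N = cong (λ k → 0ℤ , + 2 , k) (begin
    (+ N ℤ.+ ℤ.- (+ (N ∸ n))) ℤ.+ (+ N ℤ.+ ℤ.- (+ n)) ≡⟨ cong (λ k → (+ N ℤ.- k) ℤ.+ (+ N ℤ.- + n)) (+-minus-+ n≤N) ⟨
    (+ N ℤ.- (+ N ℤ.- + n)) ℤ.+ (+ N ℤ.- + n)         ≡⟨ solve 2 (λ a b → (a :- (a :- b)) :+ (a :- b) := a) refl (+ N) (+ n) ⟩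
    + N                                                ∎)
    where
    open ≡-Reasoning
    open +-*-Solver

  AvoidsLattice : Exp → Set
  AvoidsLattice e = ∀ k → k ≤ N → ¬ (e ≡ pointE k)

  AvoidsLattice-reflect : ∀ {e n} → n ≤ N → AvoidsLattice e → ¬ (subE ADE e ≡ pointE n)
  AvoidsLattice-reflect {e} {n} n≤N avoids ADE-e≡t = avoids (N ∸ n) (ℕ.m∸n≤m N n) (begin
    e                    ≡⟨ addE≡⇒≡subE {pointE n} t+e≡ADE ⟩
    subE ADE (pointE n)  ≡⟨ addE≡⇒≡subE {pointE n} (trans (addE-comm (pointE n) (pointE (N ∸ n))) (pointE-reflect n≤N)) ⟨
    pointE (N ∸ n)       ∎)
    where
    open ≡-Reasoning
    t+e≡ADE : addE (pointE n) e ≡ ADE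
    t+e≡ADE = begin
      addE (pointE n) e      ≡⟨ cong (λ t → addE t e) ADE-e≡t ⟨
      addE (subE ADE e) e    ≡⟨ addE-comm (subE ADE e) e ⟩
      addE e (subE ADE e)    ≡⟨ addE-subE e ADE ⟩
      ADE                    ∎

  -- The junk value 0, taken when u or v is the point t itself, never occurs for admissible words.
  factorAt : Exp × Exp → ℕ → Fraction
  factorAt (eu , ev) n with eu ≟E pointE n | ev ≟E pointE n
  ... | no eu≢t | no ev≢t = factor (monomial (pointE n)) (monomial eu) (monomial ev) ,
                            *P-nonZero (monomial (pointE n) -P monomial eu) (monomial (pointE n) -P monomial ev)
                              (monomial-difference-nonZero eu≢t) (monomial-difference-nonZero ev≢t)
  ... | _       | _       = zeroF , oneP-nonZero

  factorAt-avoiding : ∀ {eu ev n} → ¬ (eu ≡ pointE n) → ¬ (ev ≡ pointE n) →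
                      proj₁ (factorAt (eu , ev) n) ≡ factor (monomial (pointE n)) (monomial eu) (monomial ev)
  factorAt-avoiding {eu} {ev} {n} eu≢t ev≢t with eu ≟E pointE n | ev ≟E pointE n
  ... | no _      | no _      = refl
  ... | yes eu≡t  | _         = contradiction eu≡t eu≢t
  ... | no _      | yes ev≡t  = contradiction ev≡t ev≢t

  reflectPair : Exp × Exp → Exp × Exp
  reflectPair (eu , ev) = subE ADE ev , subE ADE eu

  BothAvoidLattice : Exp × Exp → Set
  BothAvoidLattice (eu , ev) = AvoidsLattice eu × AvoidsLattice ev

  factorAt-reflect : ∀ {n} → n ≤ N → ∀ {es} → BothAvoidLattice es →
                     proj₁ (factorAt es (N ∸ n)) ≈F proj₁ (factorAt (reflectPair es) n)
  factorAt-reflect {n} n≤N {eu , ev} (eu-avoids , ev-avoids)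
    rewrite factorAt-avoiding {eu} {ev} {N ∸ n} (eu-avoids (N ∸ n) (ℕ.m∸n≤m N n)) (ev-avoids (N ∸ n) (ℕ.m∸n≤m N n))
          | factorAt-avoiding {subE ADE ev} {subE ADE eu} {n} (AvoidsLattice-reflect n≤N ev-avoids) (AvoidsLattice-reflect n≤N eu-avoids)
    = subst (λ t → factor t′ (monomial eu) (monomial ev) ≈F factor (monomial t) (monomial (subE ADE ev)) (monomial (subE ADE eu)))
        (sym (addE≡⇒≡subE {pointE (N ∸ n)} {pointE n} (pointE-reflect n≤N)))
        (factor-reflect-monomial ADE (pointE (N ∸ n)) eu ev)
    where
    t′ : Poly
    t′ = monomial (pointE (N ∸ n))

  open ChainSums Fraction-commutativeSemiring
  open CommutativeSemiring Fraction-commutativeSemiring using (_+_; _*_; 0#)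

  proj₁-sum : ∀ xs → proj₁ (foldr _+_ 0# xs) ≡ sumF (map proj₁ xs)
  proj₁-sum []       = refl
  proj₁-sum (x ∷ xs) = cong (proj₁ x +F_) (proj₁-sum xs)

  monomialPair : Exp × Exp → Poly × Poly
  monomialPair (eu , ev) = monomial eu , monomial ev

  IqFrom≡chainSum : ∀ es lo → All BothAvoidLattice es →
                    IqFrom A N (map monomialPair es) lo ≡ proj₁ (chainSum (map factorAt es) lo N)
  IqFrom≡chainSum []               lo []                 = refl
  IqFrom≡chainSum ((eu , ev) ∷ es) lo ((eu-avoids , ev-avoids) ∷ avoid) = sym (begin
    proj₁ (foldr _+_ 0# (map (λ n → factorAt (eu , ev) n * chainSum (map factorAt es) n N) (range lo N)))
      ≡⟨ proj₁-sum (map (λ n → factorAt (eu , ev) n * chainSum (map factorAt es) n N) (range lo N)) ⟩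
    sumF (map proj₁ (map (λ n → factorAt (eu , ev) n * chainSum (map factorAt es) n N) (range lo N)))
      ≡⟨ cong sumF (List.map-∘ (range lo N)) ⟨
    sumF (map (λ n → proj₁ (factorAt (eu , ev) n) *F proj₁ (chainSum (map factorAt es) n N)) (range lo N))
      ≡⟨ cong sumF (List.map-cong-local (All.map (λ {n} n≤N →
           cong₂ _*F_ (factorAt-avoiding (eu-avoids n n≤N) (ev-avoids n n≤N)) (sym (IqFrom≡chainSum es n avoid)))
           (range-bounded lo N))) ⟩
    sumF (map (λ n → factor (monomial (pointE n)) (monomial eu) (monomial ev) *F IqFrom A N (map monomialPair es) n)
              (range lo N)) ∎)
    where open ≡-Reasoning

  paramE : ℕ → Param → Word → Word → Exp
  paramE mw pA pre suf = 0ℤ , + 1 , + N ℤ.+ + count isBCD pre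
  paramE mw pB pre suf = + 1 , 0ℤ , + (count notACAD pre ℕ.+ count isCD suf)
  paramE mw pC pre suf = -[1+ 0 ] , + 2 , (+ N ℤ.- + mw) ℤ.+ + (count notABAD pre ℕ.+ count isBD suf)
  paramE mw pD pre suf = 0ℤ , + 1 , ℤ.- (+ count isABACBC suf)

  paramVal≡monomial : ∀ mw X pre suf → paramVal N mw X pre suf ≡ monomial (paramE mw X pre suf)
  paramVal≡monomial mw pA pre suf = refl
  paramVal≡monomial mw pB pre suf = refl
  paramVal≡monomial mw pC pre suf = refl
  paramVal≡monomial mw pD pre suf = refl

  paramsE : ℕ → Letter × Word × Word → Exp × Exp
  paramsE mw (ℓ , pre , suf) = paramE mw (first ℓ) pre suf , paramE mw (second ℓ) pre suf

  lqFactors : Word → List (ℕ → Fraction)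
  lqFactors w = map (factorAt ∘ paramsE (m w)) (positions [] w)

  Lq≡IqFrom : ∀ w → Lq N w ≡ IqFrom A N (map monomialPair (map (paramsE (m w)) (positions [] w))) 0
  Lq≡IqFrom w = cong (λ ps → Iq A N ps) (trans
    (List.map-cong (λ { (ℓ , pre , suf) → cong₂ _,_ (paramVal≡monomial (m w) (first ℓ) pre suf) (paramVal≡monomial (m w) (second ℓ) pre suf) })
                   (positions [] w))
    (List.map-∘ (positions [] w)))

  paramE-avoids : ∀ mw X pre suf → 1 ≤ count isBCD pre → 1 ≤ count isABACBC suf → AvoidsLattice (paramE mw X pre suf)
  paramE-avoids mw pA pre suf pre≥1 _     k k≤N eq = positive≢nonpositive {k = k} pre≥1 (∙-cancelˡ (+ N) _ _ (cong (proj₂ ∘ proj₂) eq))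
  paramE-avoids mw pB pre suf _     _     k k≤N eq = contradiction (cong proj₁ eq) λ ()
  paramE-avoids mw pC pre suf _     _     k k≤N eq = contradiction (cong proj₁ eq) λ ()
  paramE-avoids mw pD pre suf _     suf≥1 k k≤N eq = negative≢nonnegative suf≥1 (trans (cong (proj₂ ∘ proj₂) eq) (+-minus-+ k≤N))

  paramsE-avoid : ∀ mw {w} → Admissible w → ∀ {p} → IsSplitOf w p → BothAvoidLattice (paramsE mw p)
  paramsE-avoid mw (start , end) {ℓ , _ , _} (a , b , refl , refl , refl) =
    paramE-avoids mw (first ℓ) _ _ pre≥1 suf≥1 , paramE-avoids mw (second ℓ) _ _ pre≥1 suf≥1
    where
    pre≥1 : 1 ≤ count isBCD (a ∷ʳ ℓ)
    pre≥1 = count-prefix-≥1 (λ { eAB () ; eAC () ; eAD () ; eBC _ → refl ; eBD _ → refl ; eCD _ → refl }) a ℓ b start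
    suf≥1 : 1 ≤ count isABACBC (ℓ ∷ b)
    suf≥1 = count-suffix-≥1 (λ { eAB _ → refl ; eAC _ → refl ; eAD () ; eBC _ → refl ; eBD () ; eCD () }) a ℓ b end

  paramE-mirror-A : ∀ mw pre suf → paramE mw pD (τ suf) (τ pre) ≡ subE ADE (paramE mw pA pre suf)
  paramE-mirror-A mw pre suf
    rewrite count-τ isABACBC isBCD (λ { eAB → refl ; eAC → refl ; eAD → refl ; eBC → refl ; eBD → refl ; eCD → refl }) pre =
    cong (λ k → 0ℤ , + 1 , k) (solve 2 (λ n c → :- c := n :+ :- (n :+ c)) refl (+ N) (+ count isBCD pre))
    where open +-*-Solver

  paramE-mirror-D : ∀ mw pre suf → paramE mw pA (τ suf) (τ pre) ≡ subE ADE (paramE mw pD pre suf)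
  paramE-mirror-D mw pre suf
    rewrite count-τ isBCD isABACBC (λ { eAB → refl ; eAC → refl ; eAD → refl ; eBC → refl ; eBD → refl ; eCD → refl }) suf =
    cong (λ k → 0ℤ , + 1 , k) (solve 2 (λ n c → n :+ c := n :+ :- (:- c)) refl (+ N) (+ count isABACBC suf))
    where open +-*-Solver

  -- AD = BC q^{m(w)}: the q-exponents of B at a position and of C at the mirrored one add up to N.
  complementary-exponents : ∀ {x y mw} → x ℕ.+ y ≡ mw → (+ N ℤ.- + mw) ℤ.+ + x ≡ + N ℤ.+ ℤ.- (+ y)
  complementary-exponents {x} {y} refl rewrite ℤ.pos-+ x y =
    solve 3 (λ n x y → (n :- (x :+ y)) :+ x := n :+ :- y) refl (+ N) (+ x) (+ y)
    where open +-*-Solver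

  paramE-mirror-B : ∀ mw pre suf → count isNotAD pre ℕ.+ count isNotAD suf ≡ mw →
                    paramE mw pC (τ suf) (τ pre) ≡ subE ADE (paramE mw pB pre suf)
  paramE-mirror-B mw pre suf notAD≡mw
    rewrite count-τ notABAD (notABAD ∘ τℓ) (λ _ → refl) suf | count-τ isBD (isBD ∘ τℓ) (λ _ → refl) pre =
    cong (λ k → -[1+ 0 ] , + 2 , k) (complementary-exponents (trans (count-partition-sum
      {isBD ∘ τℓ} {notACAD} {notABAD ∘ τℓ} {isCD}
      (λ { eAB → refl ; eAC → refl ; eAD → refl ; eBC → refl ; eBD → refl ; eCD → refl })
      (λ { eAB → refl ; eAC → refl ; eAD → refl ; eBC → refl ; eBD → refl ; eCD → refl }) pre suf) notAD≡mw))

  paramE-mirror-C : ∀ mw pre suf → count isNotAD pre ℕ.+ count isNotAD suf ≡ mw →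
                    paramE mw pB (τ suf) (τ pre) ≡ subE ADE (paramE mw pC pre suf)
  paramE-mirror-C mw pre suf notAD≡mw
    rewrite count-τ notACAD (notACAD ∘ τℓ) (λ _ → refl) suf | count-τ isCD (isCD ∘ τℓ) (λ _ → refl) pre =
    cong (λ k → + 1 , 0ℤ , k) (begin
      + x                                        ≡⟨ solve 2 (λ n x → x := n :+ :- (n :+ :- x)) refl (+ N) (+ x) ⟩
      + N ℤ.+ ℤ.- (+ N ℤ.+ ℤ.- (+ x))            ≡⟨ cong (λ k → + N ℤ.+ ℤ.- k) (complementary-exponents y+x≡mw) ⟨
      + N ℤ.+ ℤ.- ((+ N ℤ.- + mw) ℤ.+ + y)       ∎)
    where
    open ≡-Reasoning
    open +-*-Solver
    x y : ℕ
    x = count (notACAD ∘ τℓ) suf ℕ.+ count (isCD ∘ τℓ) pre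
    y = count notABAD pre ℕ.+ count isBD suf
    y+x≡mw : y ℕ.+ x ≡ mw
    y+x≡mw = trans (ℕ.+-comm y x) (trans (count-partition-sum
      {isCD ∘ τℓ} {notABAD} {notACAD ∘ τℓ} {isBD}
      (λ { eAB → refl ; eAC → refl ; eAD → refl ; eBC → refl ; eBD → refl ; eCD → refl })
      (λ { eAB → refl ; eAC → refl ; eAD → refl ; eBC → refl ; eBD → refl ; eCD → refl }) pre suf) notAD≡mw)

  paramsE-mirror : ∀ mw ℓ pre suf → (isNotAD ℓ ≡ true → count isNotAD pre ℕ.+ count isNotAD suf ≡ mw) →
                   paramsE mw (mirror (ℓ , pre , suf)) ≡ reflectPair (paramsE mw (ℓ , pre , suf))
  paramsE-mirror mw eAB pre suf split = cong₂ _,_ (paramE-mirror-B mw pre suf (split refl)) (paramE-mirror-A mw pre suf)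
  paramsE-mirror mw eAC pre suf split = cong₂ _,_ (paramE-mirror-C mw pre suf (split refl)) (paramE-mirror-A mw pre suf)
  paramsE-mirror mw eAD pre suf split = cong₂ _,_ (paramE-mirror-D mw pre suf) (paramE-mirror-A mw pre suf)
  paramsE-mirror mw eBC pre suf split = cong₂ _,_ (paramE-mirror-C mw pre suf (split refl)) (paramE-mirror-B mw pre suf (split refl))
  paramsE-mirror mw eBD pre suf split = cong₂ _,_ (paramE-mirror-D mw pre suf) (paramE-mirror-B mw pre suf (split refl))
  paramsE-mirror mw eCD pre suf split = cong₂ _,_ (paramE-mirror-D mw pre suf) (paramE-mirror-C mw pre suf (split refl))

  Lq≡chainSum : ∀ w → Admissible w → Lq N w ≡ proj₁ (chainSum (lqFactors w) 0 N)
  Lq≡chainSum w adm = begin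
    Lq N w
      ≡⟨ Lq≡IqFrom w ⟩
    IqFrom A N (map monomialPair (map (paramsE (m w)) (positions [] w))) 0
      ≡⟨ IqFrom≡chainSum (map (paramsE (m w)) (positions [] w)) 0
           (All-map⁺ (All.map (paramsE-avoid (m w) adm) (positions-split [] w))) ⟩
    proj₁ (chainSum (map factorAt (map (paramsE (m w)) (positions [] w))) 0 N)
      ≡⟨ cong (λ fs → proj₁ (chainSum fs 0 N)) (List.map-∘ (positions [] w)) ⟨
    proj₁ (chainSum (lqFactors w) 0 N) ∎
    where open ≡-Reasoning

  lqFactors-τ : ∀ w → Admissible w → Pointwise (AgreeBelow (suc N)) (reflect N (lqFactors w)) (lqFactors (τ w))
  lqFactors-τ w adm = subst₂ (Pointwise (AgreeBelow (suc N)))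
    (cong reverse (List.map-∘ P))
    (sym lqFactors[τw])
    (Pointwise.reverse⁺ (pointwise-map (λ p n → F p (N ∸ n)) (F ∘ mirror) mirror-agrees (positions-split [] w)))
    where
    open ≡-Reasoning
    P : List (Letter × Word × Word)
    P = positions [] w
    F : Letter × Word × Word → ℕ → Fraction
    F = factorAt ∘ paramsE (m w)
    lqFactors[τw] : lqFactors (τ w) ≡ reverse (map (F ∘ mirror) P)
    lqFactors[τw] = begin
      map (factorAt ∘ paramsE (m (τ w))) (positions [] (τ w))  ≡⟨ cong₂ (λ k ps → map (factorAt ∘ paramsE k) ps) (m-τ w) (positions-τ w) ⟩
      map F (reverse (map mirror P))                            ≡⟨ List.reverse-map F (map mirror P) ⟩
      reverse (map F (map mirror P))                            ≡⟨ cong reverse (List.map-∘ P) ⟨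
      reverse (map (F ∘ mirror) P)                              ∎
    mirror-agrees : ∀ {p} → IsSplitOf w p → AgreeBelow (suc N) (λ n → F p (N ∸ n)) (F (mirror p))
    mirror-agrees {p@(ℓ , _ , _)} split@(a , b , refl , refl , refl) n n<1+N =
      subst (λ es → proj₁ (F p (N ∸ n)) ≈F proj₁ (factorAt es n))
        (sym (paramsE-mirror (m w) ℓ (a ∷ʳ ℓ) (ℓ ∷ b) (count-isNotAD-split a ℓ b)))
        (factorAt-reflect (ℕ.≤-pred n<1+N) (paramsE-avoid (m w) adm split))

open ChainSums Fraction-commutativeSemiring using (chainSum; chainSum-reflect)

theorem4p2 : (N : ℕ) (w : Word) → Admissible w →
    NonZeroP (den (Lq N w)) × NonZeroP (den (Lq N (τ w))) × (Lq N w ≈F Lq N (τ w))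
theorem4p2 N w adm =
  subst (NonZeroP ∘ den) (sym Lq[w]≡) (proj₂ (chainSum (lqFactors N w) 0 N)) ,
  subst (NonZeroP ∘ den) (sym Lq[τw]≡) (proj₂ (chainSum (lqFactors N (τ w)) 0 N)) ,
  subst₂ _≈F_ (sym Lq[w]≡) (sym Lq[τw]≡) (chainSum-reflect N (lqFactors N w) (lqFactors N (τ w)) (lqFactors-τ N w adm))
  where
  Lq[w]≡ : Lq N w ≡ proj₁ (chainSum (lqFactors N w) 0 N)
  Lq[w]≡ = Lq≡chainSum N w adm
  Lq[τw]≡ : Lq N (τ w) ≡ proj₁ (chainSum (lqFactors N (τ w)) 0 N)
  Lq[τw]≡ = Lq≡chainSum N (τ w) (Admissible-τ w adm)
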